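{- Let $(a_n)_{n\ge 0}$ be a sequence of elements of a commutative algebra $R$ over the field $\mathbb{Q}(q)$ of rational functions in the indeterminate $q$, let $a_n^*=\sum_{i=0}^n{n \brack i}(-1)^i a_i q^{\binom{i}{2}}$ be its $q$-dual sequence, let $x,z$ be commuting indeterminates, and set $$A_n(y)=\sum_{i=0}^n(-1)^i{n \brack i}a_i q^{\binom{i}{2}}y^{n-i},\qquad A_n^*(y)=\sum_{i=0}^n(-1)^i{n \brack i}a_i^* y^{n-i},$$ $$A_n([1,-z,-x])=\sum_{i=0}^n(-1)^i{n \brack i}a_i q^{\binom{i}{2}}\,[1,-z,-x]^{n-i}.$$ Then for all integers $k,l\ge 0$: $$(-1)^l\sum_{j=0}^l{l \brack j}x^{l-j}\frac{A_{k+j+1}^*(z)}{[k+j+1]_q}q^{ -kj-\binom{k+1}{2}}+(-1)^k\sum_{j=0}^k{k \brack j}x^{k-j}\frac{A_{l+j+1}([1,-z,-x])}{[l+j+1]_q}q^{\binom{j+1}{2}-k(l+j+1)}=\frac{a_0(-x)^{k+l+1}}{[k+l+1]_q{k+l \brack k}},$$ $$(-1)^l\sum_{j=0}^l{l \brack j}x^{l-j}A_{k+j}^*(z)\,q^{k(l-j)}=(-1)^k\sum_{j=0}^k{k \brack j}x^{k-j}A_{l+j}([1,-z,-x])\,q^{\binom{k-j}{2}},$$ $$(-1)^{l+1}\sum_{j=0}^{l+1}{l+1 \brack j}x^{l+1-j}[k+j+1]_q A_{k+j}^*(z)\, q^{(k+1)(l-j)+1}=(-1)^k\sum_{j=0}^{k+1}{k+1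 \brack j}x^{k+1-j}[l+j+1]_q A_{l+j}([1,-z,-x])\, q^{\binom{k-j}{2}-j}.$$
   Context: For an integer $k$, $[k]_q=\frac{1-q^k}{1-q}$, and $[n]_q!=[1]_q[2]_q\cdots[n]_q$ with $[0]_q!=1$. For an integer $\alpha$ and integer $k$, ${\alpha \brack k}=0$ if $k<0$, ${\alpha\brack 0}=1$, and ${\alpha \brack k}=\frac{(1-q^{\alpha})\cdots(1-q^{\alpha-k+1})}{(1-q)\cdots(1-q^k)}$ for $k\ge1$ (so ${n\brack k}=0$ for integers $0\le n<k$). For every integer $m$ (including negative $m$), $\binom{m}{2}=m(m-1)/2$. For commuting elements $u,v,w$ and $n\ge 0$: $[u,v]^n=\sum_{i=0}^n{n\brack i}u^iv^{n-i}$ and $[u,v,w]^n=\sum_{i=0}^n{n\brack i}u^i[v,w]^{n-i}=\sum_{i+j+m=n,\ i,j,m\ge0}\frac{[n]_q!}{[i]_q![j]_q![m]_q!}u^iv^jw^m$. Thus $[1,-z,-x]^m$ is the polynomial $\sum_{i+j+r=m}\frac{[m]_q!}{[i]_q![j]_q![r]_q!}(-z)^j(-x)^r$. -}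

module Defs where

open import Level using (_⊔_)
open import Data.Nat using (ℕ; zero; suc; _∸_) renaming (_+_ to _+ℕ_; _*_ to _*ℕ_)
open import Data.Integer as ℤ using (ℤ; +_; -[1+_])
open import Data.List using (List; []; _∷_; replicate; _++_)
open import Data.List.Relation.Unary.Any using (Any)
open import Data.Product using (_×_)
open import Relation.Nullary using (¬_)
open import Relation.Binary.PropositionalEquality using (_≡_)
open import Algebra.Bundles using (CommutativeRing)

-- Integer polynomials (coefficient lists, constant term first)

Poly : Set
Poly = List ℤ

NonZeroPoly : Poly → Set
NonZeroPoly p = Any (λ c → ¬ (c ≡ + 0)) p

addP : Poly → Poly → Poly
addP [] q = q
addP (a ∷ p) [] = a ∷ p
addP (a ∷ p) (b ∷ q) = (a ℤ.+ b) ∷ addP p q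

shiftP : ℕ → Poly → Poly
shiftP m p = replicate m (+ 0) ++ p

qnumP : ℕ → Poly
qnumP n = replicate n (+ 1)

-- Gaussian binomial coefficient [n brack k] as a polynomial in q,
-- via the q-Pascal rule  [n+1, k+1] = [n, k] + q^(k+1) [n, k+1]
gaussP : ℕ → ℕ → Poly
gaussP n zero = + 1 ∷ []
gaussP zero (suc k) = []
gaussP (suc n) (suc k) = addP (gaussP n k) (shiftP (suc k) (gaussP n (suc k)))

C2 : ℕ → ℕ
C2 zero = zero
C2 (suc n) = n +ℕ C2 n

-- binom(m,2) = m(m-1)/2 for integer m (nonnegative result)
C2ℤ : ℤ → ℕ
C2ℤ (+ n) = C2 n
C2ℤ -[1+ n ] = C2 (suc (suc n))

module _ {c ℓ} (R : CommutativeRing c ℓ) where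
  open CommutativeRing R using (Carrier; _≈_; _+_; _*_; -_; 0#; 1#)

  ιℕ : ℕ → Carrier
  ιℕ zero = 0#
  ιℕ (suc n) = 1# + ιℕ n

  ι : ℤ → Carrier
  ι (+ n) = ιℕ n
  ι -[1+ n ] = - ιℕ (suc n)

  evalP : Carrier → Poly → Carrier
  evalP t [] = 0#
  evalP t (a ∷ p) = ι a + t * evalP t p

  -- A Q(q)-algebra structure on R, i.e. a ring map Q(q) = Frac(Z[q]) → R,
  -- is the same as an element q of R such that p(q) is a unit of R for
  -- every nonzero p ∈ Z[q]; inv p is the inverse of p(q).
  record QqAlgebra : Set (c ⊔ ℓ) where
    field
      q : Carrier
      inv : Poly → Carrier
      inv-correct : ∀ p → NonZeroPoly p → evalP q p * inv p ≈ 1#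

module QDefs {c ℓ} (R : CommutativeRing c ℓ) (Q : QqAlgebra R) where
  open CommutativeRing R using (Carrier; _≈_; _+_; _*_; -_; 0#; 1#)
  open QqAlgebra Q

  pow : Carrier → ℕ → Carrier
  pow y zero = 1#
  pow y (suc n) = y * pow y n

  sgn : ℕ → Carrier
  sgn n = pow (- 1#) n

  sumTo : ℕ → (ℕ → Carrier) → Carrier
  sumTo zero f = f zero
  sumTo (suc n) f = sumTo n f + f (suc n)

  q⁻¹ : Carrier
  q⁻¹ = inv (+ 0 ∷ + 1 ∷ [])

  qpow : ℤ → Carrier
  qpow (+ n) = pow q n
  qpow -[1+ n ] = pow q⁻¹ (suc n)

  qnum : ℕ → Carrier
  qnum n = evalP R q (qnumP n)

  qnum⁻¹ : ℕ → Carrier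
  qnum⁻¹ n = inv (qnumP n)

  qbin : ℕ → ℕ → Carrier
  qbin n k = evalP R q (gaussP n k)

  qbin⁻¹ : ℕ → ℕ → Carrier
  qbin⁻¹ n k = inv (gaussP n k)

  pow2 : Carrier → Carrier → ℕ → Carrier
  pow2 u v n = sumTo n (λ i → qbin n i * pow u i * pow v (n ∸ i))

  pow3 : Carrier → Carrier → Carrier → ℕ → Carrier
  pow3 u v w n = sumTo n (λ i → qbin n i * pow u i * pow2 v w (n ∸ i))

  dual : (ℕ → Carrier) → ℕ → Carrier
  dual a n = sumTo n (λ i → qbin n i * sgn i * a i * pow q (C2 i))

  -- A_n evaluated at a "power sequence" P (P m plays the role of y^m)
  Agen : (ℕ → Carrier) → ℕ → (ℕ → Carrier) → Carrier
  Agen a n P = sumTo n (λ i → sgn i * qbin n i * a i * pow q (C2 i) * P (n ∸ i))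

  A : (ℕ → Carrier) → ℕ → Carrier → Carrier
  A a n y = Agen a n (pow y)

  A3 : (ℕ → Carrier) → ℕ → Carrier → Carrier → Carrier
  A3 a n z x = Agen a n (pow3 1# (- z) (- x))

  A* : (ℕ → Carrier) → ℕ → Carrier → Carrier
  A* a n y = sumTo n (λ i → sgn i * qbin n i * dual a i * pow y (n ∸ i))

  Identity1 : (ℕ → Carrier) → Carrier → Carrier → ℕ → ℕ → Set ℓ
  Identity1 a x z k l =
    sgn l * sumTo l (λ j → qbin l j * pow x (l ∸ j) * A* a (k +ℕ j +ℕ 1) z
                             * qnum⁻¹ (k +ℕ j +ℕ 1)
                             * qpow (ℤ.- (+ (k *ℕ j +ℕ C2 (suc k)))))
    + sgn k * sumTo k (λ j → qbin k j * pow x (k ∸ j) * A3 a (l +ℕ j +ℕ 1) z x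
                             * qnum⁻¹ (l +ℕ j +ℕ 1)
                             * qpow (+ C2 (suc j) ℤ.- + (k *ℕ (l +ℕ j +ℕ 1))))
    ≈ a 0 * pow (- x) (k +ℕ l +ℕ 1) * (qnum⁻¹ (k +ℕ l +ℕ 1) * qbin⁻¹ (k +ℕ l) k)

  Identity2 : (ℕ → Carrier) → Carrier → Carrier → ℕ → ℕ → Set ℓ
  Identity2 a x z k l =
    sgn l * sumTo l (λ j → qbin l j * pow x (l ∸ j) * A* a (k +ℕ j) z
                             * qpow (+ (k *ℕ (l ∸ j))))
    ≈ sgn k * sumTo k (λ j → qbin k j * pow x (k ∸ j) * A3 a (l +ℕ j) z x
                             * qpow (+ C2ℤ (+ k ℤ.- + j)))

  Identity3 : (ℕ → Carrier) → Carrier → Carrier → ℕ → ℕ → Set ℓ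
  Identity3 a x z k l =
    sgn (suc l) * sumTo (suc l) (λ j → qbin (suc l) j * pow x (suc l ∸ j)
                             * qnum (k +ℕ j +ℕ 1) * A* a (k +ℕ j) z
                             * qpow (+ (suc k) ℤ.* (+ l ℤ.- + j) ℤ.+ + 1))
    ≈ sgn k * sumTo (suc k) (λ j → qbin (suc k) j * pow x (suc k ∸ j)
                             * qnum (l +ℕ j +ℕ 1) * A3 a (l +ℕ j) z x
                             * qpow (+ C2ℤ (+ k ℤ.- + j) ℤ.- + j))

{-# OPTIONS --safe #-}
module Submission where

-- Write (f ⋆ g)ₙ = Σᵢ [n,i] fᵢ gₙ₋ᵢ for the product of Eulerian generating
-- functions. With αᵢ = (-1)ⁱ aᵢ q^C(i,2) and H = α ⋆ 1 ⋆ (-z)^•, one has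
-- Hₖ = (-1)ᵏ A*ₖ(z) and Aₘ([1,-z,-x]) = (H ⋆ (-x)^•)ₘ, while by the
-- q-binomial theorem (-x)^• ⋆ (xⁱ q^C(i,2))ᵢ = δ.
--
-- After multiplication by a power of q every side of the three identities
-- is, up to sign, Σⱼ [l,j] yˡ⁻ʲ q^(k(l-j)) F_{k+j} or Σⱼ [k,j] xᵏ⁻ʲ q^C(k-j,2) G_{l+j}.
-- The q-Leibniz rule shows that (-1)ˡ times the first and (-1)ᵏ times the
-- second both satisfy W(k,l+1) = -W(k+1,l) - y qᵏ W(k,l), and such a W is
-- determined by W(·,0). Each identity thus reduces to its case l = 0, which
-- follows from the relations above; in the first identity the right-hand
-- side is a q-Beta function, which satisfies the recurrence because
-- [l+1] + q^(l+1) [k+1] = [k+l+2].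

open import Defs
open import Algebra.Bundles using (CommutativeRing)
open import Data.Nat as ℕ using (ℕ; zero; suc; _∸_; z≤n; s≤s) renaming (_+_ to _+ℕ_; _*_ to _*ℕ_)
import Data.Nat.Properties as ℕP
open import Data.Integer as ℤ using (ℤ; +_; -[1+_]; _⊖_)
import Data.Integer.Properties as ℤP
import Data.Integer.Solver as ZSolver
import Data.Nat.Solver as NSolver
open import Data.List using ([]; _∷_)
open import Data.Maybe using (Maybe; just; nothing)
open import Data.Product using (_×_; _,_; ∃)
open import Data.List.Relation.Unary.Any using (here; there)
open import Relation.Nullary using (yes; no)
open import Function using (_∘_)
open import Data.Sum using (inj₁; inj₂)
open import Relation.Binary.PropositionalEquality as ≡ using (_≡_)
import Algebra.Solver.Ring.AlmostCommutativeRing as AlmostCommutativeRing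
import Algebra.Properties.Ring as RingProperties
import Relation.Binary.Reasoning.Setoid as SetoidReasoning

∸-suc : ∀ {k n} → suc k ℕ.≤ n → n ∸ k ≡ suc (n ∸ suc k)
∸-suc (s≤s k≤n) = ℕP.+-∸-assoc 1 k≤n

module Exponents where
  open ZSolver.+-*-Solver
  open ≡.≡-Reasoning

  pos-∸ : ∀ {m n} → n ℕ.≤ m → + m ℤ.- + n ≡ + (m ∸ n)
  pos-∸ {m} {n} n≤m = ≡.trans (ℤP.m-n≡m⊖n m n) (ℤP.⊖-≥ n≤m)

  pos-*-+ : ∀ m n o → + (m *ℕ n +ℕ o) ≡ + m ℤ.* + n ℤ.+ + o
  pos-*-+ m n o = ≡.trans (ℤP.pos-+ (m *ℕ n) o) (≡.cong (ℤ._+ + o) (ℤP.pos-* m n))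

  -- Exponents involving C2 are compared after doubling, where 2 C2(i) = i(i - 1).
  C2-double : ∀ n → + C2 n ℤ.* + 2 ≡ + n ℤ.* (+ n ℤ.- + 1)
  C2-double zero    = ≡.refl
  C2-double (suc n) = begin
    + (n +ℕ C2 n) ℤ.* + 2                       ≡⟨ ≡.cong (ℤ._* + 2) (ℤP.pos-+ n (C2 n)) ⟩
    (+ n ℤ.+ + C2 n) ℤ.* + 2
      ≡⟨ solve 2 (λ N C → (N :+ C) :* con (+ 2) := N :* con (+ 2) :+ C :* con (+ 2)) ≡.refl (+ n) (+ C2 n) ⟩
    + n ℤ.* + 2 ℤ.+ + C2 n ℤ.* + 2              ≡⟨ ≡.cong (λ t → + n ℤ.* + 2 ℤ.+ t) (C2-double n) ⟩
    + n ℤ.* + 2 ℤ.+ + n ℤ.* (+ n ℤ.- + 1)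
      ≡⟨ solve 1 (λ N → N :* con (+ 2) :+ N :* (N :- con (+ 1)) := (con (+ 1) :+ N) :* ((con (+ 1) :+ N) :- con (+ 1))) ≡.refl (+ n) ⟩
    + suc n ℤ.* (+ suc n ℤ.- + 1)               ∎
  C2ℤ-double : ∀ i → + C2ℤ i ℤ.* + 2 ≡ i ℤ.* (i ℤ.- + 1)
  C2ℤ-double (+ n)     = C2-double n
  C2ℤ-double -[1+ n ]  = ≡.trans (C2-double (suc (suc n)))
    (solve 1 (λ N → (con (+ 2) :+ N) :* ((con (+ 2) :+ N) :- con (+ 1))
                 := (:- (con (+ 1) :+ N)) :* ((:- (con (+ 1) :+ N)) :- con (+ 1))) ≡.refl (+ n))

  C2ℤ-from-double : ∀ e i → e ℤ.* + 2 ≡ i ℤ.* (i ℤ.- + 1) → e ≡ + C2ℤ i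
  C2ℤ-from-double e i 2e≡i[i-1] = ℤP.*-cancelʳ-≡ e (+ C2ℤ i) (+ 2) (≡.trans 2e≡i[i-1] (≡.sym (C2ℤ-double i)))

  -[kj+c]+[kl+c]≡k[l∸j] : ∀ k l j c → j ℕ.≤ l → ℤ.- (+ (k *ℕ j +ℕ c)) ℤ.+ + (k *ℕ l +ℕ c) ≡ + (k *ℕ (l ∸ j))
  -[kj+c]+[kl+c]≡k[l∸j] k l j c j≤l = begin
    ℤ.- (+ (k *ℕ j +ℕ c)) ℤ.+ + (k *ℕ l +ℕ c)         ≡⟨ ≡.cong₂ (λ u v → ℤ.- u ℤ.+ v) (pos-*-+ k j c) (pos-*-+ k l c) ⟩
    ℤ.- (+ k ℤ.* + j ℤ.+ + c) ℤ.+ (+ k ℤ.* + l ℤ.+ + c)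
      ≡⟨ solve 4 (λ K L J C → :- (K :* J :+ C) :+ (K :* L :+ C) := K :* (L :- J)) ≡.refl (+ k) (+ l) (+ j) (+ c) ⟩
    + k ℤ.* (+ l ℤ.- + j)                             ≡⟨ ≡.cong (+ k ℤ.*_) (pos-∸ j≤l) ⟩
    + k ℤ.* + (l ∸ j)                                 ≡⟨ ℤP.pos-* k (l ∸ j) ⟨
    + (k *ℕ (l ∸ j))                                  ∎

  C2[1+j]-k[l+j+1]+[kl+C2[1+k]]≡C2[k∸j] : ∀ k l j → j ℕ.≤ k →
    (+ C2 (suc j) ℤ.- + (k *ℕ (l +ℕ j +ℕ 1))) ℤ.+ + (k *ℕ l +ℕ C2 (suc k)) ≡ + C2 (k ∸ j)
  C2[1+j]-k[l+j+1]+[kl+C2[1+k]]≡C2[k∸j] k l j j≤k =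
    ≡.trans (C2ℤ-from-double _ (K ℤ.- J) doubled) (≡.cong (λ i → + C2ℤ i) (pos-∸ j≤k))
    where
    K = + k
    L = + l
    J = + j
    doubled : ((+ C2 (suc j) ℤ.- + (k *ℕ (l +ℕ j +ℕ 1))) ℤ.+ + (k *ℕ l +ℕ C2 (suc k))) ℤ.* + 2 ≡ (K ℤ.- J) ℤ.* (K ℤ.- J ℤ.- + 1)
    doubled = begin
      ((+ C2 (suc j) ℤ.- + (k *ℕ (l +ℕ j +ℕ 1))) ℤ.+ + (k *ℕ l +ℕ C2 (suc k))) ℤ.* + 2
        ≡⟨ ≡.cong₂ (λ u v → ((+ C2 (suc j) ℤ.- u) ℤ.+ v) ℤ.* + 2)
                   (≡.trans (ℤP.pos-* k _) (≡.cong (K ℤ.*_) (≡.trans (ℤP.pos-+ (l +ℕ j) 1) (≡.cong (ℤ._+ + 1) (ℤP.pos-+ l j)))))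
                   (pos-*-+ k l (C2 (suc k))) ⟩
      ((+ C2 (suc j) ℤ.- K ℤ.* (L ℤ.+ J ℤ.+ + 1)) ℤ.+ (K ℤ.* L ℤ.+ + C2 (suc k))) ℤ.* + 2
        ≡⟨ solve 5 (λ K L J A B → ((A :- K :* (L :+ J :+ con (+ 1))) :+ (K :* L :+ B)) :* con (+ 2)
                               := A :* con (+ 2) :+ B :* con (+ 2) :- con (+ 2) :* K :* (J :+ con (+ 1)))
                   ≡.refl K L J (+ C2 (suc j)) (+ C2 (suc k)) ⟩
      + C2 (suc j) ℤ.* + 2 ℤ.+ + C2 (suc k) ℤ.* + 2 ℤ.- + 2 ℤ.* K ℤ.* (J ℤ.+ + 1)
        ≡⟨ ≡.cong₂ (λ u v → u ℤ.+ v ℤ.- + 2 ℤ.* K ℤ.* (J ℤ.+ + 1)) (C2-double (suc j)) (C2-double (suc k)) ⟩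
      + suc j ℤ.* (+ suc j ℤ.- + 1) ℤ.+ + suc k ℤ.* (+ suc k ℤ.- + 1) ℤ.- + 2 ℤ.* K ℤ.* (J ℤ.+ + 1)
        ≡⟨ solve 2 (λ K J → (con (+ 1) :+ J) :* ((con (+ 1) :+ J) :- con (+ 1)) :+ (con (+ 1) :+ K) :* ((con (+ 1) :+ K) :- con (+ 1))
                             :- con (+ 2) :* K :* (J :+ con (+ 1)) := (K :- J) :* (K :- J :- con (+ 1))) ≡.refl K J ⟩
      (K ℤ.- J) ℤ.* (K ℤ.- J ℤ.- + 1)                 ∎

  [1+k][l-j]+1+k≡[1+k][1+l∸j] : ∀ k l j → j ℕ.≤ suc l → (+ suc k ℤ.* (+ l ℤ.- + j) ℤ.+ + 1) ℤ.+ + k ≡ + (suc k *ℕ (suc l ∸ j))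
  [1+k][l-j]+1+k≡[1+k][1+l∸j] k l j j≤1+l = begin
    (+ suc k ℤ.* (+ l ℤ.- + j) ℤ.+ + 1) ℤ.+ + k
      ≡⟨ solve 3 (λ K L J → ((con (+ 1) :+ K) :* (L :- J) :+ con (+ 1)) :+ K := (con (+ 1) :+ K) :* ((con (+ 1) :+ L) :- J))
                 ≡.refl (+ k) (+ l) (+ j) ⟩
    + suc k ℤ.* (+ suc l ℤ.- + j)        ≡⟨ ≡.cong (+ suc k ℤ.*_) (pos-∸ j≤1+l) ⟩
    + suc k ℤ.* + (suc l ∸ j)            ≡⟨ ℤP.pos-* (suc k) (suc l ∸ j) ⟨
    + (suc k *ℕ (suc l ∸ j))             ∎

  C2[k-j]-j+k≡C2[1+k∸j] : ∀ k j → j ℕ.≤ suc k → (+ C2ℤ (+ k ℤ.- + j) ℤ.- + j) ℤ.+ + k ≡ + C2 (suc k ∸ j)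
  C2[k-j]-j+k≡C2[1+k∸j] k j j≤1+k =
    ≡.trans (C2ℤ-from-double _ (+ suc k ℤ.- + j) doubled) (≡.cong (λ i → + C2ℤ i) (pos-∸ j≤1+k))
    where
    D = + k ℤ.- + j
    doubled : (+ C2ℤ D ℤ.- + j ℤ.+ + k) ℤ.* + 2 ≡ (+ suc k ℤ.- + j) ℤ.* (+ suc k ℤ.- + j ℤ.- + 1)
    doubled = begin
      (+ C2ℤ D ℤ.- + j ℤ.+ + k) ℤ.* + 2
        ≡⟨ solve 3 (λ C K J → (C :- J :+ K) :* con (+ 2) := C :* con (+ 2) :+ con (+ 2) :* (K :- J)) ≡.refl (+ C2ℤ D) (+ k) (+ j) ⟩
      + C2ℤ D ℤ.* + 2 ℤ.+ + 2 ℤ.* D      ≡⟨ ≡.cong (ℤ._+ + 2 ℤ.* D) (C2ℤ-double D) ⟩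
      D ℤ.* (D ℤ.- + 1) ℤ.+ + 2 ℤ.* D
        ≡⟨ solve 2 (λ K J → (K :- J) :* ((K :- J) :- con (+ 1)) :+ con (+ 2) :* (K :- J)
                          := ((con (+ 1) :+ K) :- J) :* ((con (+ 1) :+ K) :- J :- con (+ 1))) ≡.refl (+ k) (+ j) ⟩
      (+ suc k ℤ.- + j) ℤ.* (+ suc k ℤ.- + j ℤ.- + 1) ∎

module NaturalExponents where
  open NSolver.+-*-Solver

  k[1+l]+c≡kl+c+k : ∀ k l c → k *ℕ suc l +ℕ c ≡ (k *ℕ l +ℕ c) +ℕ k
  k[1+l]+c≡kl+c+k = solve 3 (λ k l c → k :* (con 1 :+ l) :+ c := (k :* l :+ c) :+ k) ≡.refl

  [1+k]l+C2[2+k]≡kl+C2[1+k]+k+[1+l] : ∀ k l → suc k *ℕ l +ℕ C2 (suc (suc k)) ≡ ((k *ℕ l +ℕ C2 (suc k)) +ℕ k) +ℕ suc l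
  [1+k]l+C2[2+k]≡kl+C2[1+k]+k+[1+l] k l =
    solve 3 (λ k l c → (con 1 :+ k) :* l :+ ((con 1 :+ k) :+ c) := ((k :* l :+ c) :+ k) :+ (con 1 :+ l)) ≡.refl k l (C2 (suc k))

open Exponents
open NaturalExponents

module IntegerCoefficients {c ℓ} (R : CommutativeRing c ℓ) where
  open CommutativeRing R
  open RingProperties ring using (-0#≈0#; -‿involutive; -‿distribˡ-*; -‿distribʳ-*)
  open import Algebra.Properties.AbelianGroup +-abelianGroup using (⁻¹-∙-comm)
  open import Algebra.Properties.CommutativeSemigroup +-commutativeSemigroup
    using (x∙yz≈y∙xz) renaming (interchange to +-interchange)
  open SetoidReasoning setoid

  ιℕ-+ : ∀ m n → ιℕ R (m +ℕ n) ≈ ιℕ R m + ιℕ R n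
  ιℕ-+ zero    n = sym (+-identityˡ _)
  ιℕ-+ (suc m) n = trans (+-congˡ (ιℕ-+ m n)) (sym (+-assoc _ _ _))

  ιℕ-* : ∀ m n → ιℕ R (m *ℕ n) ≈ ιℕ R m * ιℕ R n
  ιℕ-* zero    n = sym (zeroˡ _)
  ιℕ-* (suc m) n = begin
    ιℕ R (n +ℕ m *ℕ n)             ≈⟨ ιℕ-+ n (m *ℕ n) ⟩
    ιℕ R n + ιℕ R (m *ℕ n)         ≈⟨ +-cong (sym (*-identityˡ _)) (ιℕ-* m n) ⟩
    1# * ιℕ R n + ιℕ R m * ιℕ R n  ≈⟨ distribʳ _ _ _ ⟨
    (1# + ιℕ R m) * ιℕ R n         ∎

  ι-⊖ : ∀ m n → ι R (m ⊖ n) ≈ ιℕ R m - ιℕ R n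
  ι-⊖ m       zero    = sym (trans (+-congˡ -0#≈0#) (+-identityʳ _))
  ι-⊖ zero    (suc n) = sym (+-identityˡ _)
  ι-⊖ (suc m) (suc n) = begin
    ι R (suc m ⊖ suc n)              ≡⟨ ≡.cong (ι R) (ℤP.[1+m]⊖[1+n]≡m⊖n m n) ⟩
    ι R (m ⊖ n)                      ≈⟨ ι-⊖ m n ⟩
    ιℕ R m - ιℕ R n                  ≈⟨ +-identityˡ _ ⟨
    0# + (ιℕ R m - ιℕ R n)           ≈⟨ +-congʳ (-‿inverseʳ 1#) ⟨
    (1# - 1#) + (ιℕ R m - ιℕ R n)    ≈⟨ +-interchange 1# (- 1#) (ιℕ R m) (- ιℕ R n) ⟩
    (1# + ιℕ R m) + (- 1# - ιℕ R n)  ≈⟨ +-congˡ (⁻¹-∙-comm 1# (ιℕ R n)) ⟩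
    (1# + ιℕ R m) - (1# + ιℕ R n)    ∎

  ι-+ : ∀ i j → ι R (i ℤ.+ j) ≈ ι R i + ι R j
  ι-+ -[1+ m ] -[1+ n ] = begin
    - (1# + ιℕ R (suc m +ℕ n))         ≈⟨ -‿cong (+-congˡ (ιℕ-+ (suc m) n)) ⟩
    - (1# + (ιℕ R (suc m) + ιℕ R n))   ≈⟨ -‿cong (x∙yz≈y∙xz 1# (ιℕ R (suc m)) (ιℕ R n)) ⟩
    - (ιℕ R (suc m) + ιℕ R (suc n))    ≈⟨ ⁻¹-∙-comm _ _ ⟨
    - ιℕ R (suc m) - ιℕ R (suc n)      ∎
  ι-+ -[1+ m ] (+ n) = trans (ι-⊖ n (suc m)) (+-comm _ _)
  ι-+ (+ m) -[1+ n ] = ι-⊖ m (suc n)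
  ι-+ (+ m) (+ n) = ιℕ-+ m n

  ι-neg : ∀ i → ι R (ℤ.- i) ≈ - ι R i
  ι-neg -[1+ n ]     = sym (-‿involutive _)
  ι-neg (+ zero)     = sym -0#≈0#
  ι-neg (+ (suc n))  = refl

  ι-*-pos : ∀ m j → ι R (+ m ℤ.* j) ≈ ιℕ R m * ι R j
  ι-*-pos m (+ n) = trans (reflexive (≡.cong (ι R) (≡.sym (ℤP.pos-* m n)))) (ιℕ-* m n)
  ι-*-pos m -[1+ n ] = begin
    ι R (+ m ℤ.* -[1+ n ])            ≡⟨ ≡.cong (ι R) (ℤP.neg-distribʳ-* (+ m) (+ suc n)) ⟨
    ι R (ℤ.- (+ m ℤ.* + suc n))       ≈⟨ ι-neg (+ m ℤ.* + suc n) ⟩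
    - ι R (+ m ℤ.* + suc n)           ≈⟨ -‿cong (ι-*-pos m (+ suc n)) ⟩
    - (ιℕ R m * ιℕ R (suc n))         ≈⟨ -‿distribʳ-* _ _ ⟩
    ιℕ R m * - ιℕ R (suc n)           ∎

  ι-* : ∀ i j → ι R (i ℤ.* j) ≈ ι R i * ι R j
  ι-* (+ m) j = ι-*-pos m j
  ι-* -[1+ m ] j = begin
    ι R (-[1+ m ] ℤ.* j)              ≡⟨ ≡.cong (ι R) (ℤP.neg-distribˡ-* (+ suc m) j) ⟨
    ι R (ℤ.- (+ suc m ℤ.* j))         ≈⟨ ι-neg (+ suc m ℤ.* j) ⟩
    - ι R (+ suc m ℤ.* j)             ≈⟨ -‿cong (ι-*-pos (suc m) j) ⟩
    - (ιℕ R (suc m) * ι R j)          ≈⟨ -‿distribˡ-* _ _ ⟩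
    - ιℕ R (suc m) * ι R j            ∎

  -- The solver interprets integer constants through ι₁ rather than ι, so
  -- that `con (+ 1)` is definitionally 1# (ι gives 1# + 0#).
  ιℕ₁ : ℕ → Carrier
  ιℕ₁ zero          = 0#
  ιℕ₁ (suc zero)    = 1#
  ιℕ₁ (suc (suc n)) = 1# + ιℕ₁ (suc n)

  ι₁ : ℤ → Carrier
  ι₁ (+ n)     = ιℕ₁ n
  ι₁ -[1+ n ]  = - ιℕ₁ (suc n)

  ιℕ₁≈ιℕ : ∀ n → ιℕ₁ n ≈ ιℕ R n
  ιℕ₁≈ιℕ zero          = refl
  ιℕ₁≈ιℕ (suc zero)    = sym (+-identityʳ 1#)
  ιℕ₁≈ιℕ (suc (suc n)) = +-congˡ (ιℕ₁≈ιℕ (suc n))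

  ι₁≈ι : ∀ i → ι₁ i ≈ ι R i
  ι₁≈ι (+ n)     = ιℕ₁≈ιℕ n
  ι₁≈ι -[1+ n ]  = -‿cong (ιℕ₁≈ιℕ (suc n))

  ι₁-homomorphism : ℤ.+-*-rawRing AlmostCommutativeRing.-Raw-AlmostCommutative⟶ AlmostCommutativeRing.fromCommutativeRing R
  ι₁-homomorphism = record
    { ⟦_⟧    = ι₁
    ; +-homo = λ i j → transport (i ℤ.+ j) (ι-+ i j) (+-cong (ι₁≈ι i) (ι₁≈ι j))
    ; *-homo = λ i j → transport (i ℤ.* j) (ι-* i j) (*-cong (ι₁≈ι i) (ι₁≈ι j))
    ; -‿homo = λ i → transport (ℤ.- i) (ι-neg i) (-‿cong (ι₁≈ι i))
    ; 0-homo = refl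
    ; 1-homo = refl
    }
    where
    transport : ∀ i {u v} → ι R i ≈ u → v ≈ u → ι₁ i ≈ v
    transport i ιi≈u v≈u = trans (ι₁≈ι i) (trans ιi≈u (sym v≈u))

  ι₁-≟ : ∀ i j → Maybe (ι₁ i ≈ ι₁ j)
  ι₁-≟ i j with i ℤ.≟ j
  ... | yes ≡.refl = just refl
  ... | no _       = nothing

  open import Algebra.Solver.Ring ℤ.+-*-rawRing (AlmostCommutativeRing.fromCommutativeRing R) ι₁-homomorphism ι₁-≟ public


module QCalculus {c ℓ} (R : CommutativeRing c ℓ) (Q : QqAlgebra R) where
  open CommutativeRing R
  open import Algebra.Properties.CommutativeSemigroup *-commutativeSemigroup
    using (x∙yz≈y∙xz) renaming (interchange to *-interchange)
  open import Algebra.Properties.CommutativeSemigroup +-commutativeSemigroup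
    using () renaming (x∙yz≈y∙xz to +-x∙yz≈y∙xz; interchange to +-interchange)
  open import Algebra.Properties.AbelianGroup +-abelianGroup using (⁻¹-∙-comm)
  open QqAlgebra Q
  open QDefs R Q
  open IntegerCoefficients R
  open SetoidReasoning setoid

  pow-cong : ∀ {a b} n → a ≈ b → pow a n ≈ pow b n
  pow-cong zero    a≈b = refl
  pow-cong (suc n) a≈b = *-cong a≈b (pow-cong n a≈b)

  pow-+ : ∀ y m n → pow y (m +ℕ n) ≈ pow y m * pow y n
  pow-+ y zero    n = sym (*-identityˡ _)
  pow-+ y (suc m) n = trans (*-congˡ (pow-+ y m n)) (sym (*-assoc _ _ _))

  pow-distrib-* : ∀ a b n → pow (a * b) n ≈ pow a n * pow b n
  pow-distrib-* a b zero    = sym (*-identityˡ _)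
  pow-distrib-* a b (suc n) = trans (*-congˡ (pow-distrib-* a b n)) (*-interchange a b (pow a n) (pow b n))

  pow-* : ∀ y m n → pow y (m *ℕ n) ≈ pow (pow y n) m
  pow-* y zero    n = refl
  pow-* y (suc m) n = trans (pow-+ y n (m *ℕ n)) (*-congˡ (pow-* y m n))

  pow-1# : ∀ n → pow 1# n ≈ 1#
  pow-1# zero    = refl
  pow-1# (suc n) = trans (*-identityˡ _) (pow-1# n)

  sgn-+ : ∀ m n → sgn (m +ℕ n) ≈ sgn m * sgn n
  sgn-+ = pow-+ (- 1#)

  sgn-suc : ∀ n → sgn (suc n) ≈ - sgn n
  sgn-suc n = solve 1 (λ s → :- con (+ 1) :* s := :- s) refl (sgn n)

  sgn-sq : ∀ n → sgn n * sgn n ≈ 1#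
  sgn-sq zero    = *-identityˡ _
  sgn-sq (suc n) = trans (solve 1 (λ s → (:- con (+ 1) :* s) :* (:- con (+ 1) :* s) := s :* s) refl (sgn n)) (sgn-sq n)

  sgn-transpose : ∀ n {u v} → sgn n * u ≈ v → u ≈ sgn n * v
  sgn-transpose n {u} {v} e = begin
    u                    ≈⟨ *-identityˡ u ⟨
    1# * u               ≈⟨ *-congʳ (sgn-sq n) ⟨
    sgn n * sgn n * u    ≈⟨ *-assoc _ _ _ ⟩
    sgn n * (sgn n * u)  ≈⟨ *-congˡ e ⟩
    sgn n * v            ∎

  pow-neg : ∀ y n → pow (- y) n ≈ sgn n * pow y n
  pow-neg y n = trans (pow-cong n (solve 1 (λ y → :- y := :- con (+ 1) :* y) refl y)) (pow-distrib-* (- 1#) y n)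

  sumTo-cong : ∀ n {f g : ℕ → Carrier} → (∀ i → i ℕ.≤ n → f i ≈ g i) → sumTo n f ≈ sumTo n g
  sumTo-cong zero    f≈g = f≈g 0 z≤n
  sumTo-cong (suc n) f≈g = +-cong (sumTo-cong n (λ i i≤n → f≈g i (ℕP.m≤n⇒m≤1+n i≤n))) (f≈g (suc n) ℕP.≤-refl)

  sumTo-+ : ∀ n (f g : ℕ → Carrier) → sumTo n (λ i → f i + g i) ≈ sumTo n f + sumTo n g
  sumTo-+ zero    f g = refl
  sumTo-+ (suc n) f g = trans (+-congʳ (sumTo-+ n f g)) (+-interchange _ _ _ _)

  *-sumTo : ∀ n a (f : ℕ → Carrier) → a * sumTo n f ≈ sumTo n (λ i → a * f i)
  *-sumTo zero    a f = refl
  *-sumTo (suc n) a f = trans (distribˡ _ _ _) (+-congʳ (*-sumTo n a f))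

  *-signed-sumTo : ∀ u s n f → u * (s * sumTo n f) ≈ s * sumTo n (λ j → u * f j)
  *-signed-sumTo u s n f = trans (x∙yz≈y∙xz u s _) (*-congˡ (*-sumTo n u f))

  neg-sumTo : ∀ n (f : ℕ → Carrier) → - sumTo n f ≈ sumTo n (λ i → - f i)
  neg-sumTo zero    f = refl
  neg-sumTo (suc n) f = trans (sym (⁻¹-∙-comm _ _)) (+-congʳ (neg-sumTo n f))

  sumTo-suc : ∀ n (f : ℕ → Carrier) → sumTo (suc n) f ≈ f 0 + sumTo n (λ i → f (suc i))
  sumTo-suc zero    f = refl
  sumTo-suc (suc n) f = trans (+-congʳ (sumTo-suc n f)) (+-assoc _ _ _)

  sumTo-zero : ∀ n (f : ℕ → Carrier) → (∀ i → i ℕ.≤ n → f i ≈ 0#) → sumTo n f ≈ 0#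
  sumTo-zero n f f≈0 = trans (sumTo-cong n f≈0) (sumTo-const0 n)
    where
    sumTo-const0 : ∀ n → sumTo n (λ _ → 0#) ≈ 0#
    sumTo-const0 zero    = refl
    sumTo-const0 (suc n) = trans (+-identityʳ _) (sumTo-const0 n)

  sumTo-drop-last : ∀ n (f : ℕ → Carrier) → f (suc n) ≈ 0# → sumTo (suc n) f ≈ sumTo n f
  sumTo-drop-last n f fₙ₊₁≈0 = trans (+-congˡ fₙ₊₁≈0) (+-identityʳ _)

  sumTo-suc-split : ∀ n (T V U : ℕ → Carrier) → T 0 ≈ U 0 → U (suc n) ≈ 0# →
                    (∀ i → i ℕ.≤ n → T (suc i) ≈ V i + U (suc i)) →
                    sumTo (suc n) T ≈ sumTo n V + sumTo n U
  sumTo-suc-split n T V U T₀≈U₀ Uₙ₊₁≈0 T≈V+U = begin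
    sumTo (suc n) T                                        ≈⟨ sumTo-suc n T ⟩
    T 0 + sumTo n (λ i → T (suc i))                        ≈⟨ +-cong T₀≈U₀ (sumTo-cong n T≈V+U) ⟩
    U 0 + sumTo n (λ i → V i + U (suc i))                  ≈⟨ +-congˡ (sumTo-+ n V (λ i → U (suc i))) ⟩
    U 0 + (sumTo n V + sumTo n (λ i → U (suc i)))          ≈⟨ +-x∙yz≈y∙xz _ _ _ ⟩
    sumTo n V + (U 0 + sumTo n (λ i → U (suc i)))          ≈⟨ +-congˡ (sumTo-suc n U) ⟨
    sumTo n V + sumTo (suc n) U                            ≈⟨ +-congˡ (sumTo-drop-last n U Uₙ₊₁≈0) ⟩
    sumTo n V + sumTo n U                                  ∎

  cancel-inverseˡ : ∀ {u u⁻¹ w} → u * u⁻¹ ≈ 1# → u * (u⁻¹ * w) ≈ w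
  cancel-inverseˡ uu⁻¹≈1 = trans (sym (*-assoc _ _ _)) (trans (*-congʳ uu⁻¹≈1) (*-identityˡ _))

  cancelˡ : ∀ {u u⁻¹ a b} → u * u⁻¹ ≈ 1# → u * a ≈ u * b → a ≈ b
  cancelˡ {u} {u⁻¹} uu⁻¹≈1 ua≈ub = trans (sym (u⁻¹u-cancel _)) (trans (*-congˡ ua≈ub) (u⁻¹u-cancel _))
    where
    u⁻¹u-cancel : ∀ w → u⁻¹ * (u * w) ≈ w
    u⁻¹u-cancel w = cancel-inverseˡ (trans (*-comm u⁻¹ u) uu⁻¹≈1)

  inverse-transpose : ∀ {u u⁻¹ v v⁻¹ r} → u * u⁻¹ ≈ 1# → v * v⁻¹ ≈ 1# → u * r ≈ v → u⁻¹ ≈ r * v⁻¹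
  inverse-transpose {u} {u⁻¹} {v} {v⁻¹} {r} uu⁻¹≈1 vv⁻¹≈1 ur≈v = begin
    u⁻¹                     ≈⟨ *-identityʳ u⁻¹ ⟨
    u⁻¹ * 1#                ≈⟨ *-congˡ vv⁻¹≈1 ⟨
    u⁻¹ * (v * v⁻¹)         ≈⟨ *-congˡ (*-congʳ ur≈v) ⟨
    u⁻¹ * (u * r * v⁻¹)     ≈⟨ solve 4 (λ a b c d → a :* (b :* c :* d) := (b :* a) :* (c :* d)) refl u⁻¹ u r v⁻¹ ⟩
    u * u⁻¹ * (r * v⁻¹)     ≈⟨ trans (*-congʳ uu⁻¹≈1) (*-identityˡ _) ⟩
    r * v⁻¹                 ∎

  -- Gaussian binomial coefficients and q-numbers

  evalP-addP : ∀ t p r → evalP R t (addP p r) ≈ evalP R t p + evalP R t r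
  evalP-addP t []      r       = sym (+-identityˡ _)
  evalP-addP t (a ∷ p) []      = sym (+-identityʳ _)
  evalP-addP t (a ∷ p) (b ∷ r) = begin
    ι R (a ℤ.+ b) + t * evalP R t (addP p r)         ≈⟨ +-cong (ι-+ a b) (*-congˡ (evalP-addP t p r)) ⟩
    (ι R a + ι R b) + t * (evalP R t p + evalP R t r)
      ≈⟨ solve 5 (λ a b t u v → (a :+ b) :+ t :* (u :+ v) := (a :+ t :* u) :+ (b :+ t :* v)) refl _ _ t _ _ ⟩
    (ι R a + t * evalP R t p) + (ι R b + t * evalP R t r) ∎

  evalP-shiftP : ∀ t m p → evalP R t (shiftP m p) ≈ pow t m * evalP R t p
  evalP-shiftP t zero    p = sym (*-identityˡ _)
  evalP-shiftP t (suc m) p = trans (+-identityˡ _) (trans (*-congˡ (evalP-shiftP t m p)) (sym (*-assoc _ _ _)))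

  qbin-zero : ∀ n → qbin n 0 ≈ 1#
  qbin-zero n = trans (+-congˡ (zeroʳ q)) (trans (+-identityʳ _) (+-identityʳ 1#))

  q-pascal : ∀ n k → qbin (suc n) (suc k) ≈ qbin n k + pow q (suc k) * qbin n (suc k)
  q-pascal n k = trans (evalP-addP q (gaussP n k) _) (+-congˡ (evalP-shiftP q (suc k) (gaussP n (suc k))))

  qbin-> : ∀ n k → n ℕ.< k → qbin n k ≈ 0#
  qbin-> zero    (suc k) _         = refl
  qbin-> (suc n) (suc k) (s≤s n<k) = begin
    qbin (suc n) (suc k)                          ≈⟨ q-pascal n k ⟩
    qbin n k + pow q (suc k) * qbin n (suc k)     ≈⟨ +-cong (qbin-> n k n<k) (*-congˡ (qbin-> n (suc k) (ℕP.m≤n⇒m≤1+n n<k))) ⟩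
    0# + pow q (suc k) * 0#                       ≈⟨ trans (+-identityˡ _) (zeroʳ _) ⟩
    0#                                            ∎

  qbin-diag : ∀ n → qbin n n ≈ 1#
  qbin-diag zero    = qbin-zero 0
  qbin-diag (suc n) = begin
    qbin (suc n) (suc n)                          ≈⟨ q-pascal n n ⟩
    qbin n n + pow q (suc n) * qbin n (suc n)     ≈⟨ +-cong (qbin-diag n) (*-congˡ (qbin-> n (suc n) ℕP.≤-refl)) ⟩
    1# + pow q (suc n) * 0#                       ≈⟨ trans (+-congˡ (zeroʳ _)) (+-identityʳ 1#) ⟩
    1#                                            ∎

  pow-∸-qbin : ∀ n k → pow q (n ∸ k) * qbin n (suc k) ≈ q * pow q (n ∸ suc k) * qbin n (suc k)
  pow-∸-qbin n k with suc k ℕ.≤? n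
  ... | yes k<n = *-congʳ (reflexive (≡.cong (pow q) (∸-suc k<n)))
  ... | no  k≮n = trans (*-congˡ vanish) (trans (zeroʳ _) (sym (trans (*-congˡ vanish) (zeroʳ _))))
    where vanish = qbin-> n (suc k) (ℕP.≰⇒> k≮n)

  q-pascal′ : ∀ n k → qbin (suc n) (suc k) ≈ pow q (n ∸ k) * qbin n k + qbin n (suc k)
  q-pascal′ zero    zero    = trans (qbin-diag 1) (sym (trans (+-identityʳ _) (trans (*-identityˡ _) (qbin-zero 0))))
  q-pascal′ zero    (suc k) = trans (qbin-> 1 (suc (suc k)) (s≤s (s≤s z≤n))) (sym (trans (+-identityʳ _) (zeroʳ _)))
  q-pascal′ (suc n) zero    = begin
    qbin (suc (suc n)) 1                                 ≈⟨ q-pascal (suc n) 0 ⟩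
    qbin (suc n) 0 + pow q 1 * qbin (suc n) 1            ≈⟨ +-cong (qbin-zero (suc n)) (*-congˡ (q-pascal′ n 0)) ⟩
    1# + pow q 1 * (pow q n * qbin n 0 + qbin n 1)       ≈⟨ +-congˡ (*-congˡ (+-congʳ (*-congˡ (qbin-zero n)))) ⟩
    1# + pow q 1 * (pow q n * 1# + qbin n 1)
      ≈⟨ solve 3 (λ q p b → con (+ 1) :+ q :* con (+ 1) :* (p :* con (+ 1) :+ b)
                         := q :* p :* con (+ 1) :+ (con (+ 1) :+ q :* con (+ 1) :* b)) refl q (pow q n) (qbin n 1) ⟩
    pow q (suc n) * 1# + (1# + pow q 1 * qbin n 1)       ≈⟨ +-cong (*-congˡ (qbin-zero (suc n))) (+-congʳ (qbin-zero n)) ⟨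
    pow q (suc n) * qbin (suc n) 0 + (qbin n 0 + pow q 1 * qbin n 1) ≈⟨ +-congˡ (q-pascal n 0) ⟨
    pow q (suc n) * qbin (suc n) 0 + qbin (suc n) 1      ∎
  q-pascal′ (suc n) (suc k) = begin
    qbin (suc (suc n)) (suc (suc k))                       ≈⟨ q-pascal (suc n) (suc k) ⟩
    qbin (suc n) (suc k) + Q₂ * qbin (suc n) (suc (suc k)) ≈⟨ +-cong (q-pascal′ n k) (*-congˡ (q-pascal′ n (suc k))) ⟩
    (Qd * b₀ + b₁) + Q₂ * (Qd₁ * b₁ + b₂)
      ≈⟨ solve 7 (λ q Q₁ Qd Qd₁ b₀ b₁ b₂ → (Qd :* b₀ :+ b₁) :+ (q :* Q₁) :* (Qd₁ :* b₁ :+ b₂)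
                                        := Qd :* b₀ :+ b₁ :+ Q₁ :* (q :* Qd₁ :* b₁) :+ (q :* Q₁) :* b₂) refl q Q₁ Qd Qd₁ b₀ b₁ b₂ ⟩
    Qd * b₀ + b₁ + Q₁ * (q * Qd₁ * b₁) + Q₂ * b₂         ≈⟨ +-congʳ (+-congˡ (*-congˡ (pow-∸-qbin n k))) ⟨
    Qd * b₀ + b₁ + Q₁ * (Qd * b₁) + Q₂ * b₂
      ≈⟨ solve 6 (λ q Q₁ Qd b₀ b₁ b₂ → Qd :* b₀ :+ b₁ :+ Q₁ :* (Qd :* b₁) :+ (q :* Q₁) :* b₂
                                      := Qd :* (b₀ :+ Q₁ :* b₁) :+ (b₁ :+ (q :* Q₁) :* b₂)) refl q Q₁ Qd b₀ b₁ b₂ ⟩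
    Qd * (b₀ + Q₁ * b₁) + (b₁ + Q₂ * b₂)                   ≈⟨ +-cong (*-congˡ (q-pascal n k)) (q-pascal n (suc k)) ⟨
    Qd * qbin (suc n) (suc k) + qbin (suc n) (suc (suc k)) ∎
    where
    Qd = pow q (n ∸ k)
    Q₁ = pow q (suc k)
    Q₂ = pow q (suc (suc k))
    b₀ = qbin n k
    b₁ = qbin n (suc k)
    b₂ = qbin n (suc (suc k))
    Qd₁ = pow q (n ∸ suc k)

  qnum-suc : ∀ n → qnum (suc n) ≈ 1# + q * qnum n
  qnum-suc n = +-congʳ (+-identityʳ 1#)

  qnum-one : qnum 1 ≈ 1#
  qnum-one = trans (qnum-suc 0) (trans (+-congˡ (zeroʳ q)) (+-identityʳ 1#))

  qnum-+ : ∀ m n → qnum (m +ℕ n) ≈ qnum m + pow q m * qnum n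
  qnum-+ zero    n = solve 1 (λ x → x := con (+ 0) :+ con (+ 1) :* x) refl (qnum n)
  qnum-+ (suc m) n = begin
    qnum (suc m +ℕ n)                           ≈⟨ qnum-suc (m +ℕ n) ⟩
    1# + q * qnum (m +ℕ n)                      ≈⟨ +-congˡ (*-congˡ (qnum-+ m n)) ⟩
    1# + q * (qnum m + pow q m * qnum n)
      ≈⟨ solve 4 (λ q a p b → con (+ 1) :+ q :* (a :+ p :* b) := (con (+ 1) :+ q :* a) :+ (q :* p) :* b) refl q (qnum m) (pow q m) (qnum n) ⟩
    (1# + q * qnum m) + pow q (suc m) * qnum n  ≈⟨ +-congʳ (qnum-suc m) ⟨
    qnum (suc m) + pow q (suc m) * qnum n       ∎

  [1-q]*[n]≈1-qⁿ : ∀ n → (1# - q) * qnum n ≈ 1# - pow q n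
  [1-q]*[n]≈1-qⁿ zero    = solve 1 (λ q → (con (+ 1) :- q) :* con (+ 0) := con (+ 1) :- con (+ 1)) refl q
  [1-q]*[n]≈1-qⁿ (suc n) = begin
    (1# - q) * qnum (suc n)                     ≈⟨ *-congˡ (qnum-suc n) ⟩
    (1# - q) * (1# + q * qnum n)
      ≈⟨ solve 2 (λ q a → (con (+ 1) :- q) :* (con (+ 1) :+ q :* a) := con (+ 1) :- q :+ q :* ((con (+ 1) :- q) :* a)) refl q (qnum n) ⟩
    1# - q + q * ((1# - q) * qnum n)            ≈⟨ +-congˡ (*-congˡ ([1-q]*[n]≈1-qⁿ n)) ⟩
    1# - q + q * (1# - pow q n)
      ≈⟨ solve 2 (λ q p → con (+ 1) :- q :+ q :* (con (+ 1) :- p) := con (+ 1) :- q :* p) refl q (pow q n) ⟩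
    1# - pow q (suc n)                          ∎

  [1-q]*[n]u≈[1-qⁿ]u : ∀ n u → (1# - q) * (qnum n * u) ≈ (1# - pow q n) * u
  [1-q]*[n]u≈[1-qⁿ]u n u = trans (sym (*-assoc _ _ _)) (*-congʳ ([1-q]*[n]≈1-qⁿ n))

  q-inverse : q * q⁻¹ ≈ 1#
  q-inverse = trans (*-congʳ evalP-q) (inv-correct _ (there (here λ ())))
    where
    evalP-q : q ≈ evalP R q (+ 0 ∷ + 1 ∷ [])
    evalP-q = solve 1 (λ q → q := con (+ 0) :+ q :* ((con (+ 1) :+ con (+ 0)) :+ q :* con (+ 0))) refl q

  pow-q-inverse : ∀ n → pow q n * pow q⁻¹ n ≈ 1#
  pow-q-inverse zero    = *-identityˡ _
  pow-q-inverse (suc n) = begin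
    q * pow q n * (q⁻¹ * pow q⁻¹ n)        ≈⟨ *-interchange _ _ _ _ ⟩
    q * q⁻¹ * (pow q n * pow q⁻¹ n)        ≈⟨ *-cong q-inverse (pow-q-inverse n) ⟩
    1# * 1#                                ≈⟨ *-identityˡ 1# ⟩
    1#                                     ∎

  1-q-inverse : (1# - q) * inv (+ 1 ∷ -[1+ 0 ] ∷ []) ≈ 1#
  1-q-inverse = trans (*-congʳ evalP-1-q) (inv-correct _ (here λ ()))
    where
    evalP-1-q : 1# - q ≈ evalP R q (+ 1 ∷ -[1+ 0 ] ∷ [])
    evalP-1-q = solve 1 (λ q → con (+ 1) :- q := (con (+ 1) :+ con (+ 0)) :+ q :* (:- (con (+ 1) :+ con (+ 0)) :+ q :* con (+ 0))) refl q

  qnum-inverse : ∀ n → qnum (suc n) * qnum⁻¹ (suc n) ≈ 1#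
  qnum-inverse n = inv-correct _ (here λ ())

  gaussP-head : ∀ n k → k ℕ.≤ n → ∃ λ rest → gaussP n k ≡ + 1 ∷ rest
  gaussP-head n       zero    _         = [] , ≡.refl
  gaussP-head (suc n) (suc k) (s≤s k≤n) with gaussP-head n k k≤n
  ... | rest , eq rewrite eq = _ , ≡.refl

  qbin-inverse : ∀ n k → k ℕ.≤ n → qbin n k * qbin⁻¹ n k ≈ 1#
  qbin-inverse n k k≤n with gaussP-head n k k≤n
  ... | rest , eq = inv-correct _ (≡.subst NonZeroPoly (≡.sym eq) (here λ ()))

  1-q-cancelˡ : ∀ {a b} → (1# - q) * a ≈ (1# - q) * b → a ≈ b
  1-q-cancelˡ = cancelˡ 1-q-inverse

  pow-q-cancelˡ : ∀ n {a b} → pow q n * a ≈ pow q n * b → a ≈ b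
  pow-q-cancelˡ n = cancelˡ (pow-q-inverse n)

  qnum-cancelˡ : ∀ n {a b} → qnum (suc n) * a ≈ qnum (suc n) * b → a ≈ b
  qnum-cancelˡ n = cancelˡ (qnum-inverse n)

  qpow-⊖ : ∀ m n → qpow (m ⊖ n) ≈ pow q m * pow q⁻¹ n
  qpow-⊖ m       zero    = sym (*-identityʳ _)
  qpow-⊖ zero    (suc n) = sym (*-identityˡ _)
  qpow-⊖ (suc m) (suc n) = begin
    qpow (suc m ⊖ suc n)                   ≡⟨ ≡.cong qpow (ℤP.[1+m]⊖[1+n]≡m⊖n m n) ⟩
    qpow (m ⊖ n)                           ≈⟨ qpow-⊖ m n ⟩
    pow q m * pow q⁻¹ n                    ≈⟨ *-identityˡ _ ⟨
    1# * (pow q m * pow q⁻¹ n)             ≈⟨ *-congʳ q-inverse ⟨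
    q * q⁻¹ * (pow q m * pow q⁻¹ n)        ≈⟨ *-interchange _ _ _ _ ⟩
    pow q (suc m) * pow q⁻¹ (suc n)        ∎

  qpow-+ : ∀ i j → qpow (i ℤ.+ j) ≈ qpow i * qpow j
  qpow-+ -[1+ m ] -[1+ n ] = trans (reflexive (≡.cong (pow q⁻¹ ∘ suc) (≡.sym (ℕP.+-suc m n)))) (pow-+ q⁻¹ (suc m) (suc n))
  qpow-+ -[1+ m ] (+ n)    = trans (qpow-⊖ n (suc m)) (*-comm _ _)
  qpow-+ (+ m)    -[1+ n ] = qpow-⊖ m (suc n)
  qpow-+ (+ m)    (+ n)    = pow-+ q m n

  qpow-shift : ∀ e k m → e ℤ.+ + k ≡ + m → pow q k * qpow e ≈ pow q m
  qpow-shift e k m e+k≡m = trans (*-comm _ _) (trans (sym (qpow-+ e (+ k))) (reflexive (≡.cong qpow e+k≡m)))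

  pow-suc-∸ : ∀ {j n} → j ℕ.≤ n → pow q (suc j) * pow q (n ∸ j) ≈ pow q (suc n)
  pow-suc-∸ {j} {n} j≤n = trans (sym (pow-+ q (suc j) (n ∸ j))) (reflexive (≡.cong (pow q ∘ suc) (ℕP.m+[n∸m]≡n j≤n)))

  qbin-absorbˡ-scaled : ∀ n j → j ℕ.≤ n → (1# - pow q (suc j)) * qbin (suc n) (suc j) ≈ (1# - pow q (suc n)) * qbin n j
  qbin-absorbˡ-scaled n j j≤n = begin
    (1# - Q₁) * b′                             ≈⟨ solve 2 (λ Q a → (con (+ 1) :- Q) :* a := a :- Q :* a) refl Q₁ b′ ⟩
    b′ - Q₁ * b′                                ≈⟨ +-cong (q-pascal n j) (-‿cong (*-congˡ (q-pascal′ n j))) ⟩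
    (b₀ + Q₁ * b₁) - Q₁ * (Qd * b₀ + b₁)
      ≈⟨ solve 4 (λ Q₁ Qd b₀ b₁ → (b₀ :+ Q₁ :* b₁) :- Q₁ :* (Qd :* b₀ :+ b₁) := (con (+ 1) :- Q₁ :* Qd) :* b₀) refl Q₁ Qd b₀ b₁ ⟩
    (1# - Q₁ * Qd) * b₀                       ≈⟨ *-congʳ (+-congˡ (-‿cong (pow-suc-∸ j≤n))) ⟩
    (1# - pow q (suc n)) * b₀                 ∎
    where
    b′ = qbin (suc n) (suc j)
    Q₁ = pow q (suc j)
    Qd = pow q (n ∸ j)
    b₀ = qbin n j
    b₁ = qbin n (suc j)

  qbin-absorbʳ-scaled : ∀ n j → j ℕ.≤ n → (1# - pow q (n ∸ j)) * qbin (suc n) (suc j) ≈ (1# - pow q (suc n)) * qbin n (suc j)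
  qbin-absorbʳ-scaled n j j≤n = begin
    (1# - Qd) * b′                             ≈⟨ solve 2 (λ Q a → (con (+ 1) :- Q) :* a := a :- Q :* a) refl Qd b′ ⟩
    b′ - Qd * b′                                ≈⟨ +-cong (q-pascal′ n j) (-‿cong (*-congˡ (q-pascal n j))) ⟩
    (Qd * b₀ + b₁) - Qd * (b₀ + Q₁ * b₁)
      ≈⟨ solve 4 (λ Q₁ Qd b₀ b₁ → (Qd :* b₀ :+ b₁) :- Qd :* (b₀ :+ Q₁ :* b₁) := (con (+ 1) :- Q₁ :* Qd) :* b₁) refl Q₁ Qd b₀ b₁ ⟩
    (1# - Q₁ * Qd) * b₁                       ≈⟨ *-congʳ (+-congˡ (-‿cong (pow-suc-∸ j≤n))) ⟩
    (1# - pow q (suc n)) * b₁                 ∎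
    where
    b′ = qbin (suc n) (suc j)
    Q₁ = pow q (suc j)
    Qd = pow q (n ∸ j)
    b₀ = qbin n j
    b₁ = qbin n (suc j)

  [1-qᵘ]a≈[1-qᵛ]b⇒a[u]≈[v]b : ∀ u v {a b} → (1# - pow q u) * a ≈ (1# - pow q v) * b → a * qnum u ≈ qnum v * b
  [1-qᵘ]a≈[1-qᵛ]b⇒a[u]≈[v]b u v {a} {b} e = 1-q-cancelˡ (begin
    (1# - q) * (a * qnum u)      ≈⟨ x∙yz≈y∙xz _ _ _ ⟩
    a * ((1# - q) * qnum u)      ≈⟨ trans (*-congˡ ([1-q]*[n]≈1-qⁿ u)) (*-comm _ _) ⟩
    (1# - pow q u) * a           ≈⟨ e ⟩
    (1# - pow q v) * b           ≈⟨ *-congʳ ([1-q]*[n]≈1-qⁿ v) ⟨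
    (1# - q) * qnum v * b        ≈⟨ *-assoc _ _ _ ⟩
    (1# - q) * (qnum v * b)      ∎)

  qbin-absorbˡ : ∀ n j → j ℕ.≤ n → qbin (suc n) (suc j) * qnum (suc j) ≈ qnum (suc n) * qbin n j
  qbin-absorbˡ n j j≤n = [1-qᵘ]a≈[1-qᵛ]b⇒a[u]≈[v]b (suc j) (suc n) (qbin-absorbˡ-scaled n j j≤n)

  qbin-absorbʳ : ∀ n j → j ℕ.≤ n → qbin (suc n) j * qnum (suc n ∸ j) ≈ qnum (suc n) * qbin n j
  qbin-absorbʳ n zero    _           = trans (*-congʳ (qbin-zero (suc n))) (trans (*-comm _ _) (*-congˡ (sym (qbin-zero n))))
  qbin-absorbʳ n (suc j) (s≤s j<n) = [1-qᵘ]a≈[1-qᵛ]b⇒a[u]≈[v]b (n ∸ j) (suc n) (qbin-absorbʳ-scaled n j (ℕP.m≤n⇒m≤1+n j<n))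

  qbin-suc-diag : ∀ n → qbin (suc n) n ≈ qnum (suc n)
  qbin-suc-diag n = begin
    qbin (suc n) n                          ≈⟨ *-identityʳ _ ⟨
    qbin (suc n) n * 1#                     ≈⟨ *-congˡ (trans (reflexive (≡.cong qnum (ℕP.m+n∸n≡m 1 n))) qnum-one) ⟨
    qbin (suc n) n * qnum (suc n ∸ n)       ≈⟨ qbin-absorbʳ n n ℕP.≤-refl ⟩
    qnum (suc n) * qbin n n                 ≈⟨ trans (*-congˡ (qbin-diag n)) (*-identityʳ _) ⟩
    qnum (suc n)                            ∎

  -- The q-Beta function B(k+1, l+1) = [k]! [l]! / [k+l+1]!.
  β : ℕ → ℕ → Carrier
  β k l = qnum⁻¹ (suc (k +ℕ l)) * qbin⁻¹ (k +ℕ l) k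

  β-inverse : ∀ k l → qnum (suc (k +ℕ l)) * qbin (k +ℕ l) k * β k l ≈ 1#
  β-inverse k l = trans (*-interchange _ _ _ _)
    (trans (*-cong (qnum-inverse (k +ℕ l)) (qbin-inverse (k +ℕ l) k (ℕP.m≤m+n k l))) (*-identityˡ 1#))

  qnum-β-sucˡ : ∀ k l → qnum (suc (suc (k +ℕ l))) * β (suc k) l ≈ qnum (suc k) * β k l
  qnum-β-sucˡ k l = begin
    qnum (suc (suc n)) * (qnum⁻¹ (suc (suc n)) * qbin⁻¹ (suc n) (suc k))  ≈⟨ cancel-inverseˡ (qnum-inverse (suc n)) ⟩
    qbin⁻¹ (suc n) (suc k)
      ≈⟨ inverse-transpose (qbin-inverse (suc n) (suc k) (s≤s k≤n)) (β-inverse k l) (qbin-absorbˡ n k k≤n) ⟩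
    qnum (suc k) * β k l                                                 ∎
    where
    n = k +ℕ l
    k≤n = ℕP.m≤m+n k l

  qnum-β-sucʳ : ∀ k l → qnum (suc (suc (k +ℕ l))) * β k (suc l) ≈ qnum (suc l) * β k l
  qnum-β-sucʳ k l = begin
    qnum (suc (suc n)) * β k (suc l)
      ≡⟨ ≡.cong (λ m → qnum (suc (suc n)) * (qnum⁻¹ (suc m) * qbin⁻¹ m k)) (ℕP.+-suc k l) ⟩
    qnum (suc (suc n)) * (qnum⁻¹ (suc (suc n)) * qbin⁻¹ (suc n) k)       ≈⟨ cancel-inverseˡ (qnum-inverse (suc n)) ⟩
    qbin⁻¹ (suc n) k
      ≈⟨ inverse-transpose (qbin-inverse (suc n) k (ℕP.m≤n⇒m≤1+n k≤n)) (β-inverse k l) (qbin-absorbʳ n k k≤n) ⟩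
    qnum (suc n ∸ k) * β k l
      ≡⟨ ≡.cong (λ m → qnum m * β k l) (≡.trans (ℕP.+-∸-assoc 1 k≤n) (≡.cong suc (ℕP.m+n∸m≡n k l))) ⟩
    qnum (suc l) * β k l                                                 ∎
    where
    n = k +ℕ l
    k≤n = ℕP.m≤m+n k l

  β-recurrence : ∀ k l → β k (suc l) ≈ β k l - pow q (suc l) * β (suc k) l
  β-recurrence k l = qnum-cancelˡ (suc (k +ℕ l)) (begin
    N * β k (suc l)                                       ≈⟨ qnum-β-sucʳ k l ⟩
    qnum (suc l) * β k l
      ≈⟨ solve 4 (λ a b c d → a :* d := (a :+ b :* c) :* d :- b :* (c :* d)) refl (qnum (suc l)) (pow q (suc l)) (qnum (suc k)) (β k l) ⟩
    (qnum (suc l) + pow q (suc l) * qnum (suc k)) * β k l - pow q (suc l) * (qnum (suc k) * β k l)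
      ≈⟨ +-cong (*-congʳ (sym qnum-split)) (-‿cong (*-congˡ (sym (qnum-β-sucˡ k l)))) ⟩
    N * β k l - pow q (suc l) * (N * β (suc k) l)
      ≈⟨ solve 4 (λ n b p c → n :* b :- p :* (n :* c) := n :* (b :- p :* c)) refl N (β k l) (pow q (suc l)) (β (suc k) l) ⟩
    N * (β k l - pow q (suc l) * β (suc k) l)             ∎)
    where
    N = qnum (suc (suc (k +ℕ l)))
    qnum-split : N ≈ qnum (suc l) + pow q (suc l) * qnum (suc k)
    qnum-split = trans (reflexive (≡.cong (qnum ∘ suc) (≡.trans (≡.cong suc (ℕP.+-comm k l)) (≡.sym (ℕP.+-suc l k))))) (qnum-+ (suc l) (suc k))

  -- Eulerian convolution

  Seq : Set c
  Seq = ℕ → Carrier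

  _⋆_ : Seq → Seq → Seq
  (f ⋆ g) n = sumTo n (λ i → qbin n i * f i * g (n ∸ i))

  shift : Seq → Seq
  shift f i = f (suc i)

  dilate : Seq → Seq
  dilate f i = pow q i * f i

  δ : Seq
  δ zero    = 1#
  δ (suc _) = 0#

  ⋆-cong : ∀ n {f f′ g g′ : Seq} → (∀ i → i ℕ.≤ n → f i ≈ f′ i) → (∀ i → i ℕ.≤ n → g i ≈ g′ i) →
           (f ⋆ g) n ≈ (f′ ⋆ g′) n
  ⋆-cong n f≈f′ g≈g′ = sumTo-cong n (λ i i≤n → *-cong (*-congˡ (f≈f′ i i≤n)) (g≈g′ (n ∸ i) (ℕP.m∸n≤m n i)))

  ⋆-congˡ : ∀ n {f f′ : Seq} g → (∀ i → i ℕ.≤ n → f i ≈ f′ i) → (f ⋆ g) n ≈ (f′ ⋆ g) n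
  ⋆-congˡ n g f≈f′ = ⋆-cong n {g = g} {g′ = g} f≈f′ (λ _ _ → refl)

  ⋆-congʳ : ∀ n f {g g′ : Seq} → (∀ i → i ℕ.≤ n → g i ≈ g′ i) → (f ⋆ g) n ≈ (f ⋆ g′) n
  ⋆-congʳ n f g≈g′ = ⋆-cong n {f = f} {f′ = f} (λ _ _ → refl) g≈g′

  ⋆-distribʳ-+ : ∀ n (f f′ g : Seq) → ((λ i → f i + f′ i) ⋆ g) n ≈ (f ⋆ g) n + (f′ ⋆ g) n
  ⋆-distribʳ-+ n f f′ g = trans (sumTo-cong n (λ i _ → solve 4 (λ b x y z → b :* (x :+ y) :* z := b :* x :* z :+ b :* y :* z) refl _ _ _ _))
                                (sumTo-+ n _ _)

  ⋆-distribˡ-+ : ∀ n (f g g′ : Seq) → (f ⋆ (λ i → g i + g′ i)) n ≈ (f ⋆ g) n + (f ⋆ g′) n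
  ⋆-distribˡ-+ n f g g′ = trans (sumTo-cong n (λ i _ → solve 4 (λ b x y z → b :* x :* (y :+ z) := b :* x :* y :+ b :* x :* z) refl _ _ _ _))
                                (sumTo-+ n _ _)

  ⋆-*ˡ : ∀ n a (f g : Seq) → ((λ i → a * f i) ⋆ g) n ≈ a * (f ⋆ g) n
  ⋆-*ˡ n a f g = trans (sumTo-cong n (λ i _ → solve 4 (λ b a x y → b :* (a :* x) :* y := a :* (b :* x :* y)) refl _ _ _ _))
                       (sym (*-sumTo n a _))

  ⋆-*ʳ : ∀ n a (f g : Seq) → (f ⋆ (λ i → a * g i)) n ≈ a * (f ⋆ g) n
  ⋆-*ʳ n a f g = trans (sumTo-cong n (λ i _ → solve 4 (λ b a x y → b :* x :* (a :* y) := a :* (b :* x :* y)) refl _ _ _ _))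
                       (sym (*-sumTo n a _))

  ⋆-negˡ : ∀ n (f g : Seq) → ((λ i → - f i) ⋆ g) n ≈ - (f ⋆ g) n
  ⋆-negˡ n f g = trans (sumTo-cong n (λ i _ → solve 3 (λ b x y → b :* (:- x) :* y := :- (b :* x :* y)) refl _ _ _))
                       (sym (neg-sumTo n _))

  ⋆-zero : ∀ (f g : Seq) → (f ⋆ g) 0 ≈ f 0 * g 0
  ⋆-zero f g = trans (*-congʳ (*-congʳ (qbin-zero 0))) (*-congʳ (*-identityˡ _))

  ⋆-shiftˡ : ∀ n (f g : Seq) → (f ⋆ g) (suc n) ≈ (shift f ⋆ g) n + (dilate f ⋆ shift g) n
  ⋆-shiftˡ n f g = trans (sumTo-suc-split n T _ U T₀≈U₀ Uₙ₊₁≈0 step) (+-congˡ (sumTo-cong n shift-g))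
    where
    T U : ℕ → Carrier
    T i = qbin (suc n) i * f i * g (suc n ∸ i)
    U i = qbin n i * dilate f i * g (suc n ∸ i)
    T₀≈U₀ : T 0 ≈ U 0
    T₀≈U₀ = *-congʳ (*-cong (trans (qbin-zero (suc n)) (sym (qbin-zero n))) (sym (*-identityˡ _)))
    Uₙ₊₁≈0 : U (suc n) ≈ 0#
    Uₙ₊₁≈0 = trans (*-congʳ (*-congʳ (qbin-> n (suc n) ℕP.≤-refl))) (trans (*-congʳ (zeroˡ _)) (zeroˡ _))
    step : ∀ i → i ℕ.≤ n → T (suc i) ≈ qbin n i * f (suc i) * g (n ∸ i) + U (suc i)
    step i _ = trans (*-congʳ (*-congʳ (q-pascal n i)))
      (solve 5 (λ a p b x y → (a :+ p :* b) :* x :* y := a :* x :* y :+ b :* (p :* x) :* y) refl _ _ _ _ _)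
    shift-g : ∀ i → i ℕ.≤ n → U i ≈ qbin n i * dilate f i * shift g (n ∸ i)
    shift-g i i≤n = *-congˡ (reflexive (≡.cong g (ℕP.+-∸-assoc 1 i≤n)))

  ⋆-shiftʳ : ∀ n (f g : Seq) → (f ⋆ g) (suc n) ≈ (f ⋆ shift g) n + (shift f ⋆ dilate g) n
  ⋆-shiftʳ n f g = trans (sumTo-suc-split n T _ U T₀≈U₀ Uₙ₊₁≈0 step) (trans (+-comm _ _) (+-congʳ (sumTo-cong n shift-g)))
    where
    T U : ℕ → Carrier
    T i = qbin (suc n) i * f i * g (suc n ∸ i)
    U i = qbin n i * f i * g (suc n ∸ i)
    T₀≈U₀ : T 0 ≈ U 0
    T₀≈U₀ = *-congʳ (*-congʳ (trans (qbin-zero (suc n)) (sym (qbin-zero n))))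
    Uₙ₊₁≈0 : U (suc n) ≈ 0#
    Uₙ₊₁≈0 = trans (*-congʳ (*-congʳ (qbin-> n (suc n) ℕP.≤-refl))) (trans (*-congʳ (zeroˡ _)) (zeroˡ _))
    step : ∀ i → i ℕ.≤ n → T (suc i) ≈ qbin n i * f (suc i) * dilate g (n ∸ i) + U (suc i)
    step i _ = trans (*-congʳ (*-congʳ (q-pascal′ n i)))
      (solve 5 (λ p a b x y → (p :* a :+ b) :* x :* y := a :* x :* (p :* y) :+ b :* x :* y) refl _ _ _ _ _)
    shift-g : ∀ i → i ℕ.≤ n → U i ≈ qbin n i * f i * shift g (n ∸ i)
    shift-g i i≤n = *-congˡ (reflexive (≡.cong g (ℕP.+-∸-assoc 1 i≤n)))

  dilate-⋆ : ∀ n (f g : Seq) → pow q n * (f ⋆ g) n ≈ (dilate f ⋆ dilate g) n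
  dilate-⋆ n f g = trans (*-sumTo n _ _) (sumTo-cong n λ i i≤n →
    trans (*-congʳ (trans (reflexive (≡.cong (pow q) (≡.sym (ℕP.m+[n∸m]≡n i≤n)))) (pow-+ q i (n ∸ i))))
          (solve 5 (λ a b c x y → (a :* b) :* (c :* x :* y) := c :* (a :* x) :* (b :* y)) refl _ _ _ _ _))

  ⋆-identityʳ : ∀ n (f : Seq) → (f ⋆ δ) n ≈ f n
  ⋆-identityʳ zero    f = trans (⋆-zero f δ) (*-identityʳ _)
  ⋆-identityʳ (suc n) f = begin
    (f ⋆ δ) (suc n)                                       ≈⟨ +-congʳ (sumTo-zero n _ λ i i≤n →
                                                               trans (*-congˡ (reflexive (≡.cong δ (ℕP.+-∸-assoc 1 i≤n)))) (zeroʳ _)) ⟩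
    0# + qbin (suc n) (suc n) * f (suc n) * δ (n ∸ n)    ≈⟨ +-identityˡ _ ⟩
    qbin (suc n) (suc n) * f (suc n) * δ (n ∸ n)         ≈⟨ *-cong (*-congʳ (qbin-diag (suc n))) (reflexive (≡.cong δ (ℕP.n∸n≡0 n))) ⟩
    1# * f (suc n) * 1#                                   ≈⟨ trans (*-identityʳ _) (*-identityˡ _) ⟩
    f (suc n)                                             ∎

  ⋆-assoc : ∀ n (f g h : Seq) → ((f ⋆ g) ⋆ h) n ≈ (f ⋆ (g ⋆ h)) n
  ⋆-assoc zero    f g h = begin
    ((f ⋆ g) ⋆ h) 0        ≈⟨ trans (⋆-zero (f ⋆ g) h) (*-congʳ (⋆-zero f g)) ⟩
    f 0 * g 0 * h 0        ≈⟨ *-assoc _ _ _ ⟩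
    f 0 * (g 0 * h 0)      ≈⟨ trans (⋆-zero f (g ⋆ h)) (*-congˡ (⋆-zero g h)) ⟨
    (f ⋆ (g ⋆ h)) 0        ∎
  ⋆-assoc (suc n) f g h = begin
    ((f ⋆ g) ⋆ h) (suc n)
      ≈⟨ ⋆-shiftˡ n (f ⋆ g) h ⟩
    (shift (f ⋆ g) ⋆ h) n + (dilate (f ⋆ g) ⋆ shift h) n
      ≈⟨ +-cong (⋆-congˡ n h (λ i _ → ⋆-shiftˡ i f g)) (⋆-congˡ n (shift h) (λ i _ → dilate-⋆ i f g)) ⟩
    ((λ i → (shift f ⋆ g) i + (dilate f ⋆ shift g) i) ⋆ h) n + ((dilate f ⋆ dilate g) ⋆ shift h) n
      ≈⟨ +-congʳ (⋆-distribʳ-+ n (shift f ⋆ g) (dilate f ⋆ shift g) h) ⟩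
    (((shift f ⋆ g) ⋆ h) n + ((dilate f ⋆ shift g) ⋆ h) n) + ((dilate f ⋆ dilate g) ⋆ shift h) n
      ≈⟨ +-cong (+-cong (⋆-assoc n (shift f) g h) (⋆-assoc n (dilate f) (shift g) h)) (⋆-assoc n (dilate f) (dilate g) (shift h)) ⟩
    ((shift f ⋆ (g ⋆ h)) n + (dilate f ⋆ (shift g ⋆ h)) n) + (dilate f ⋆ (dilate g ⋆ shift h)) n
      ≈⟨ +-assoc _ _ _ ⟩
    (shift f ⋆ (g ⋆ h)) n + ((dilate f ⋆ (shift g ⋆ h)) n + (dilate f ⋆ (dilate g ⋆ shift h)) n)
      ≈⟨ +-congˡ (trans (sym (⋆-distribˡ-+ n (dilate f) (shift g ⋆ h) (dilate g ⋆ shift h)))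
                        (⋆-congʳ n (dilate f) (λ i _ → sym (⋆-shiftˡ i g h)))) ⟩
    (shift f ⋆ (g ⋆ h)) n + (dilate f ⋆ shift (g ⋆ h)) n
      ≈⟨ ⋆-shiftˡ n f (g ⋆ h) ⟨
    (f ⋆ (g ⋆ h)) (suc n)  ∎

  sgn-⋆ : ∀ n (f g : Seq) → sgn n * (f ⋆ g) n ≈ ((λ i → sgn i * f i) ⋆ (λ i → sgn i * g i)) n
  sgn-⋆ n f g = trans (*-sumTo n _ _) (sumTo-cong n λ i i≤n →
    trans (*-congʳ (trans (reflexive (≡.cong sgn (≡.sym (ℕP.m+[n∸m]≡n i≤n)))) (sgn-+ i (n ∸ i))))
          (solve 5 (λ a b c x y → (a :* b) :* (c :* x :* y) := c :* (a :* x) :* (b :* y)) refl _ _ _ _ _))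

  qnum-⋆-antiderivative : ∀ k (f g : Seq) →
    qnum (suc k) * ((λ j → f (suc j) * qnum⁻¹ (suc j)) ⋆ g) k ≈ (f ⋆ g) (suc k) - f 0 * g (suc k)
  qnum-⋆-antiderivative k f g = begin
    qnum (suc k) * ((λ j → f (suc j) * qnum⁻¹ (suc j)) ⋆ g) k   ≈⟨ trans (*-sumTo k _ _) (sumTo-cong k term) ⟩
    sumTo k (λ j → T (suc j))                                   ≈⟨ solve 2 (λ s t → s := (t :+ s) :- t) refl _ (T 0) ⟩
    (T 0 + sumTo k (λ j → T (suc j))) - T 0
      ≈⟨ +-cong (sumTo-suc k T) (-‿cong (sym (*-congʳ (trans (*-congʳ (qbin-zero (suc k))) (*-identityˡ _))))) ⟨
    (f ⋆ g) (suc k) - f 0 * g (suc k)                           ∎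
    where
    T : ℕ → Carrier
    T i = qbin (suc k) i * f i * g (suc k ∸ i)
    term : ∀ j → j ℕ.≤ k → qnum (suc k) * (qbin k j * (f (suc j) * qnum⁻¹ (suc j)) * g (k ∸ j)) ≈ T (suc j)
    term j j≤k = begin
      qnum (suc k) * (qbin k j * (f (suc j) * qnum⁻¹ (suc j)) * g (k ∸ j))
        ≈⟨ solve 5 (λ n b u v w → n :* (b :* (u :* v) :* w) := (n :* b) :* v :* u :* w) refl _ _ _ _ _ ⟩
      qnum (suc k) * qbin k j * qnum⁻¹ (suc j) * f (suc j) * g (k ∸ j)             ≈⟨ *-congʳ (*-congʳ (*-congʳ (qbin-absorbˡ k j j≤k))) ⟨
      qbin (suc k) (suc j) * qnum (suc j) * qnum⁻¹ (suc j) * f (suc j) * g (k ∸ j)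
        ≈⟨ *-congʳ (*-congʳ (trans (*-assoc _ _ _) (trans (*-congˡ (qnum-inverse j)) (*-identityʳ _)))) ⟩
      T (suc j)                                                                   ∎

  ⋆-degree≤1 : ∀ (f g : Seq) → (∀ m → g (suc (suc m)) ≈ 0#) → ∀ k →
               (f ⋆ g) (suc k) ≈ qbin (suc k) k * f k * g 1 + qbin (suc k) (suc k) * f (suc k) * g 0
  ⋆-degree≤1 f g g≈0 zero    = refl
  ⋆-degree≤1 f g g≈0 (suc k) = begin
    (sumTo k T + T (suc k)) + T (suc (suc k))
      ≈⟨ +-congʳ (+-congʳ (sumTo-zero k T λ i i≤k →
           trans (*-congˡ (reflexive (≡.cong g (∸-suc-suc i≤k)))) (trans (*-congˡ (g≈0 _)) (zeroʳ _)))) ⟩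
    (0# + T (suc k)) + T (suc (suc k))
      ≈⟨ +-cong (trans (+-identityˡ _) (*-congˡ (reflexive (≡.cong g (ℕP.m+n∸n≡m 1 k))))) (*-congˡ (reflexive (≡.cong g (ℕP.n∸n≡0 k)))) ⟩
    qbin (suc (suc k)) (suc k) * f (suc k) * g 1 + qbin (suc (suc k)) (suc (suc k)) * f (suc (suc k)) * g 0 ∎
    where
    T : ℕ → Carrier
    T i = qbin (suc (suc k)) i * f i * g (suc (suc k) ∸ i)
    ∸-suc-suc : ∀ {i} → i ℕ.≤ k → suc (suc k) ∸ i ≡ suc (suc (k ∸ i))
    ∸-suc-suc {i} i≤k = ℕP.+-∸-assoc 2 i≤k

  -- The q-binomial theorem

  qexp : Carrier → Seq
  qexp x i = pow x i * pow q (C2 i)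

  shift-qexp : ∀ x i → shift (qexp x) i ≈ x * dilate (qexp x) i
  shift-qexp x i = trans (*-congˡ (pow-+ q i (C2 i)))
    (solve 4 (λ x a b c → (x :* a) :* (b :* c) := x :* (b :* (a :* c))) refl x (pow x i) (pow q i) (pow q (C2 i)))

  dilate-pow : ∀ y i → dilate (pow y) i ≈ pow (q * y) i
  dilate-pow y i = sym (pow-distrib-* q y i)

  -- (pow y ⋆ qexp x) n = ∏_{i<n} (y + x qⁱ)
  pow-⋆-qexp-suc : ∀ y x n → (pow y ⋆ qexp x) (suc n) ≈ (y + x * pow q n) * (pow y ⋆ qexp x) n
  pow-⋆-qexp-suc y x n = begin
    (pow y ⋆ qexp x) (suc n)                                 ≈⟨ ⋆-shiftˡ n (pow y) (qexp x) ⟩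
    (shift (pow y) ⋆ qexp x) n + (dilate (pow y) ⋆ shift (qexp x)) n
      ≈⟨ +-cong (⋆-*ˡ n y (pow y) (qexp x)) (⋆-congʳ n (dilate (pow y)) (λ i _ → shift-qexp x i)) ⟩
    y * E n + (dilate (pow y) ⋆ (λ i → x * dilate (qexp x) i)) n
      ≈⟨ +-congˡ (trans (⋆-*ʳ n x (dilate (pow y)) (dilate (qexp x))) (*-congˡ (sym (dilate-⋆ n (pow y) (qexp x))))) ⟩
    y * E n + x * (pow q n * E n)
      ≈⟨ solve 4 (λ y e x p → y :* e :+ x :* (p :* e) := (y :+ x :* p) :* e) refl y _ x _ ⟩
    (y + x * pow q n) * E n                                  ∎
    where E = pow y ⋆ qexp x

  pow-⋆-qexp-zero : ∀ y x → (pow y ⋆ qexp x) 0 ≈ 1#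
  pow-⋆-qexp-zero y x = trans (⋆-zero (pow y) (qexp x)) (trans (*-identityˡ _) (*-identityˡ _))

  pow-⋆-qexp-vanish : ∀ y x i → y + x * pow q i ≈ 0# → ∀ n → i ℕ.< n → (pow y ⋆ qexp x) n ≈ 0#
  pow-⋆-qexp-vanish y x i root (suc n) (s≤s i≤n) with ℕP.m≤n⇒m<n∨m≡n i≤n
  ... | inj₁ i<n   = trans (pow-⋆-qexp-suc y x n) (trans (*-congˡ (pow-⋆-qexp-vanish y x i root n i<n)) (zeroʳ _))
  ... | inj₂ ≡.refl = trans (pow-⋆-qexp-suc y x n) (trans (*-congʳ root) (zeroˡ _))

  pow-neg-⋆-qexp : ∀ x n → (pow (- x) ⋆ qexp x) n ≈ δ n
  pow-neg-⋆-qexp x zero    = pow-⋆-qexp-zero (- x) x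
  pow-neg-⋆-qexp x (suc n) = pow-⋆-qexp-vanish (- x) x 0 root (suc n) (s≤s z≤n)
    where root = solve 1 (λ x → :- x :+ x :* con (+ 1) := con (+ 0)) refl x

  pow-neg-q-⋆-qexp-one : ∀ x → (pow (q * - x) ⋆ qexp x) 1 ≈ (1# - q) * x
  pow-neg-q-⋆-qexp-one x = trans (pow-⋆-qexp-suc (q * - x) x 0) (trans (*-congˡ (pow-⋆-qexp-zero (q * - x) x))
    (solve 2 (λ q x → (q :* :- x :+ x :* con (+ 1)) :* con (+ 1) := (con (+ 1) :- q) :* x) refl q x))

  pow-neg-q-⋆-qexp-vanish : ∀ x m → (pow (q * - x) ⋆ qexp x) (suc (suc m)) ≈ 0#
  pow-neg-q-⋆-qexp-vanish x m = pow-⋆-qexp-vanish (q * - x) x 1 root (suc (suc m)) (s≤s (s≤s z≤n))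
    where root = solve 2 (λ q x → q :* :- x :+ x :* (q :* con (+ 1)) := con (+ 0)) refl q x

  -- Two-index sums and their recurrence

  lsum : Seq → Carrier → ℕ → ℕ → Carrier
  lsum F y k l = sumTo l (λ j → qbin l j * pow y (l ∸ j) * pow q (k *ℕ (l ∸ j)) * F (k +ℕ j))

  rsum : Seq → Carrier → ℕ → ℕ → Carrier
  rsum G x k l = sumTo k (λ j → qbin k j * pow x (k ∸ j) * pow q (C2 (k ∸ j)) * G (l +ℕ j))

  lsum-⋆ : ∀ F y k l → lsum F y k l ≈ ((λ j → F (k +ℕ j)) ⋆ pow (y * pow q k)) l
  lsum-⋆ F y k l = sumTo-cong l λ j _ →
    trans (solve 4 (λ b a p f → b :* a :* p :* f := b :* f :* (a :* p)) refl _ _ _ _) (*-congˡ (pow-qk (l ∸ j)))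
    where
    pow-qk : ∀ m → pow y m * pow q (k *ℕ m) ≈ pow (y * pow q k) m
    pow-qk m = begin
      pow y m * pow q (k *ℕ m)      ≡⟨ ≡.cong (λ e → pow y m * pow q e) (ℕP.*-comm k m) ⟩
      pow y m * pow q (m *ℕ k)      ≈⟨ *-congˡ (pow-* q m k) ⟩
      pow y m * pow (pow q k) m     ≈⟨ pow-distrib-* y (pow q k) m ⟨
      pow (y * pow q k) m           ∎

  rsum-⋆ : ∀ G x k l → rsum G x k l ≈ ((λ j → G (l +ℕ j)) ⋆ qexp x) k
  rsum-⋆ G x k l = sumTo-cong k λ j _ → solve 4 (λ b a p g → b :* a :* p :* g := b :* g :* (a :* p)) refl _ _ _ _

  lsum-zero : ∀ F y k → lsum F y k 0 ≈ F k
  lsum-zero F y k = begin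
    qbin 0 0 * 1# * pow q (k *ℕ 0) * F (k +ℕ 0)   ≡⟨ ≡.cong₂ (λ e i → qbin 0 0 * 1# * pow q e * F i) (ℕP.*-zeroʳ k) (ℕP.+-identityʳ k) ⟩
    qbin 0 0 * 1# * 1# * F k                     ≈⟨ *-congʳ (trans (*-identityʳ _) (trans (*-identityʳ _) (qbin-zero 0))) ⟩
    1# * F k                                     ≈⟨ *-identityˡ _ ⟩
    F k                                          ∎

  lsum-one : ∀ F y k → lsum F y k 1 ≈ y * pow q k * F k + F (suc k)
  lsum-one F y k = +-cong first second
    where
    first : qbin 1 0 * pow y 1 * pow q (k *ℕ 1) * F (k +ℕ 0) ≈ y * pow q k * F k
    first = begin
      qbin 1 0 * pow y 1 * pow q (k *ℕ 1) * F (k +ℕ 0)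
        ≡⟨ ≡.cong₂ (λ e i → qbin 1 0 * pow y 1 * pow q e * F i) (ℕP.*-identityʳ k) (ℕP.+-identityʳ k) ⟩
      qbin 1 0 * (y * 1#) * pow q k * F k
        ≈⟨ *-congʳ (*-congʳ (trans (*-congʳ (qbin-zero 1)) (trans (*-identityˡ _) (*-identityʳ y)))) ⟩
      y * pow q k * F k                                ∎
    second : qbin 1 1 * pow y 0 * pow q (k *ℕ 0) * F (k +ℕ 1) ≈ F (suc k)
    second = begin
      qbin 1 1 * 1# * pow q (k *ℕ 0) * F (k +ℕ 1)      ≡⟨ ≡.cong₂ (λ e i → qbin 1 1 * 1# * pow q e * F i) (ℕP.*-zeroʳ k) (ℕP.+-comm k 1) ⟩
      qbin 1 1 * 1# * 1# * F (suc k)                   ≈⟨ *-congʳ (trans (*-identityʳ _) (trans (*-identityʳ _) (qbin-diag 1))) ⟩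
      1# * F (suc k)                                   ≈⟨ *-identityˡ _ ⟩
      F (suc k)                                        ∎

  lsum-suc : ∀ F y k l → lsum F y k (suc l) ≈ lsum F y (suc k) l + y * pow q k * lsum F y k l
  lsum-suc F y k l = begin
    lsum F y k (suc l)                                    ≈⟨ lsum-⋆ F y k (suc l) ⟩
    (Fₖ ⋆ pow yₖ) (suc l)                                  ≈⟨ ⋆-shiftʳ l Fₖ (pow yₖ) ⟩
    (Fₖ ⋆ shift (pow yₖ)) l + (shift Fₖ ⋆ dilate (pow yₖ)) l
      ≈⟨ +-cong (⋆-*ʳ l yₖ Fₖ (pow yₖ)) (⋆-cong l (λ j _ → reflexive (≡.cong F (ℕP.+-suc k j))) (λ i _ → dilate-yₖ i)) ⟩
    yₖ * (Fₖ ⋆ pow yₖ) l + ((λ j → F (suc k +ℕ j)) ⋆ pow (y * pow q (suc k))) l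
      ≈⟨ +-cong (*-congˡ (lsum-⋆ F y k l)) (lsum-⋆ F y (suc k) l) ⟨
    yₖ * lsum F y k l + lsum F y (suc k) l                ≈⟨ +-comm _ _ ⟩
    lsum F y (suc k) l + yₖ * lsum F y k l                ∎
    where
    yₖ = y * pow q k
    Fₖ : Seq
    Fₖ j = F (k +ℕ j)
    dilate-yₖ : ∀ i → dilate (pow yₖ) i ≈ pow (y * pow q (suc k)) i
    dilate-yₖ i = trans (dilate-pow yₖ i) (pow-cong i (x∙yz≈y∙xz q y (pow q k)))

  rsum-suc : ∀ G x k l → rsum G x (suc k) l ≈ rsum G x k (suc l) + x * pow q k * rsum G x k l
  rsum-suc G x k l = begin
    rsum G x (suc k) l                                    ≈⟨ rsum-⋆ G x (suc k) l ⟩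
    (Gₗ ⋆ qexp x) (suc k)                                  ≈⟨ ⋆-shiftˡ k Gₗ (qexp x) ⟩
    (shift Gₗ ⋆ qexp x) k + (dilate Gₗ ⋆ shift (qexp x)) k
      ≈⟨ +-cong (⋆-congˡ k (qexp x) (λ j _ → reflexive (≡.cong G (ℕP.+-suc l j)))) (⋆-congʳ k (dilate Gₗ) (λ i _ → shift-qexp x i)) ⟩
    ((λ j → G (suc l +ℕ j)) ⋆ qexp x) k + (dilate Gₗ ⋆ (λ i → x * dilate (qexp x) i)) k
      ≈⟨ +-cong (sym (rsum-⋆ G x k (suc l))) (⋆-*ʳ k x (dilate Gₗ) (dilate (qexp x))) ⟩
    rsum G x k (suc l) + x * (dilate Gₗ ⋆ dilate (qexp x)) k
      ≈⟨ +-congˡ (*-congˡ (dilate-⋆ k Gₗ (qexp x))) ⟨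
    rsum G x k (suc l) + x * (pow q k * (Gₗ ⋆ qexp x) k)  ≈⟨ +-congˡ (trans (*-assoc _ _ _) (*-congˡ (*-congˡ (rsum-⋆ G x k l)))) ⟨
    rsum G x k (suc l) + x * pow q k * rsum G x k l       ∎
    where
    Gₗ : Seq
    Gₗ j = G (l +ℕ j)

  Recurrence : (ℕ → Carrier) → (ℕ → ℕ → Carrier) → Set ℓ
  Recurrence γ W = ∀ k l → W k (suc l) ≈ - W (suc k) l - γ k * W k l

  recurrence-unique : ∀ γ U V → Recurrence γ U → Recurrence γ V → (∀ k → U k 0 ≈ V k 0) → ∀ l k → U k l ≈ V k l
  recurrence-unique γ U V recU recV base zero    k = base k
  recurrence-unique γ U V recU recV base (suc l) k = begin
    U k (suc l)                     ≈⟨ recU k l ⟩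
    - U (suc k) l - γ k * U k l     ≈⟨ +-cong (-‿cong (IH (suc k))) (-‿cong (*-congˡ (IH k))) ⟩
    - V (suc k) l - γ k * V k l     ≈⟨ recV k l ⟨
    V k (suc l)                     ∎
    where IH = recurrence-unique γ U V recU recV base l

  recurrence-+ : ∀ γ U V → Recurrence γ U → Recurrence γ V → Recurrence γ (λ k l → U k l + V k l)
  recurrence-+ γ U V recU recV k l = trans (+-cong (recU k l) (recV k l))
    (solve 5 (λ u₁ u c v₁ v → (:- u₁ :- c :* u) :+ (:- v₁ :- c :* v) := :- (u₁ :+ v₁) :- c :* (u :+ v)) refl
      (U (suc k) l) (U k l) (γ k) (V (suc k) l) (V k l))

  recurrence-neg : ∀ γ W → Recurrence γ W → Recurrence γ (λ k l → - W k l)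
  recurrence-neg γ W recW k l = trans (-‿cong (recW k l))
    (solve 3 (λ u₁ c u → :- (:- u₁ :- c :* u) := :- (:- u₁) :- c :* (:- u)) refl (W (suc k) l) (γ k) (W k l))

  recurrence-cong : ∀ {γ γ′} W → (∀ k → γ k ≈ γ′ k) → Recurrence γ W → Recurrence γ′ W
  recurrence-cong W γ≈γ′ recW k l = trans (recW k l) (+-congˡ (-‿cong (*-congʳ (γ≈γ′ k))))

  lsum-recurrence : ∀ F y → Recurrence (λ k → y * pow q k) (λ k l → sgn l * lsum F y k l)
  lsum-recurrence F y k l = trans (*-cong (sgn-suc l) (lsum-suc F y k l))
    (solve 4 (λ s a c b → :- s :* (a :+ c :* b) := :- (s :* a) :- c :* (s :* b)) refl (sgn l) _ _ _)

  rsum-recurrence : ∀ G x → Recurrence (λ k → x * pow q k) (λ k l → sgn k * rsum G x k l)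
  rsum-recurrence G x k l = trans (solve 4 (λ s a c b → s :* a := :- (:- s :* (a :+ c :* b)) :- c :* (s :* b)) refl (sgn k) _ _ _)
    (+-congʳ (-‿cong (sym (*-cong (sgn-suc k) (rsum-suc G x k l)))))

module Identities {c ℓ} (R : CommutativeRing c ℓ) (Q : QqAlgebra R)
                  (a : ℕ → CommutativeRing.Carrier R) (x z : CommutativeRing.Carrier R) where
  open CommutativeRing R
  open QqAlgebra Q
  open QDefs R Q
  open IntegerCoefficients R
  open QCalculus R Q
  open SetoidReasoning setoid
  open import Algebra.Properties.CommutativeSemigroup *-commutativeSemigroup using (x∙yz≈y∙xz)

  α : Seq
  α i = sgn i * a i * pow q (C2 i)

  F G H : Seq
  F k = A* a k z
  G m = A3 a m z x
  H   = (α ⋆ pow 1#) ⋆ pow (- z)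

  Agen-⋆ : ∀ n (P : Seq) → Agen a n P ≈ (α ⋆ P) n
  Agen-⋆ n P = sumTo-cong n λ i _ → solve 5 (λ s b a p w → s :* b :* a :* p :* w := b :* (s :* a :* p) :* w) refl _ _ _ _ _

  dual-⋆ : ∀ n → dual a n ≈ (α ⋆ pow 1#) n
  dual-⋆ n = sumTo-cong n λ i _ →
    trans (solve 4 (λ b s a p → b :* s :* a :* p := b :* (s :* a :* p) :* con (+ 1)) refl _ _ _ _) (*-congˡ (sym (pow-1# (n ∸ i))))

  F-⋆ : ∀ k → F k ≈ ((λ i → sgn i * dual a i) ⋆ pow z) k
  F-⋆ k = sumTo-cong k λ i _ → solve 4 (λ s b d p → s :* b :* d :* p := b :* (s :* d) :* p) refl _ _ _ _

  G-⋆ : ∀ m → G m ≈ (H ⋆ pow (- x)) m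
  G-⋆ m = begin
    G m                                                 ≈⟨ Agen-⋆ m (pow3 1# (- z) (- x)) ⟩
    (α ⋆ (pow 1# ⋆ (pow (- z) ⋆ pow (- x)))) m          ≈⟨ ⋆-congʳ m α (λ i _ → ⋆-assoc i (pow 1#) (pow (- z)) (pow (- x))) ⟨
    (α ⋆ ((pow 1# ⋆ pow (- z)) ⋆ pow (- x))) m          ≈⟨ ⋆-assoc m α (pow 1# ⋆ pow (- z)) (pow (- x)) ⟨
    ((α ⋆ (pow 1# ⋆ pow (- z))) ⋆ pow (- x)) m          ≈⟨ ⋆-congˡ m (pow (- x)) (λ i _ → ⋆-assoc i α (pow 1#) (pow (- z))) ⟨
    (H ⋆ pow (- x)) m                                   ∎

  H≈sgn*F : ∀ k → H k ≈ sgn k * F k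
  H≈sgn*F k = sgn-transpose k (begin
    sgn k * H k                                                       ≈⟨ sgn-⋆ k (α ⋆ pow 1#) (pow (- z)) ⟩
    ((λ i → sgn i * (α ⋆ pow 1#) i) ⋆ (λ i → sgn i * pow (- z) i)) k
      ≈⟨ ⋆-cong k (λ i _ → *-congˡ (sym (dual-⋆ i))) (λ i _ → sym (sgn-transpose i (sym (pow-neg z i)))) ⟩
    ((λ i → sgn i * dual a i) ⋆ pow z) k                              ≈⟨ F-⋆ k ⟨
    F k                                                               ∎)

  G-⋆-qexp : ∀ m → (G ⋆ qexp x) m ≈ H m
  G-⋆-qexp m = begin
    (G ⋆ qexp x) m                        ≈⟨ ⋆-congˡ m (qexp x) (λ i _ → G-⋆ i) ⟩
    ((H ⋆ pow (- x)) ⋆ qexp x) m          ≈⟨ ⋆-assoc m H (pow (- x)) (qexp x) ⟩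
    (H ⋆ (pow (- x) ⋆ qexp x)) m          ≈⟨ ⋆-congʳ m H (λ i _ → pow-neg-⋆-qexp x i) ⟩
    (H ⋆ δ) m                             ≈⟨ ⋆-identityʳ m H ⟩
    H m                                   ∎

  identity2 : ∀ k l → Identity2 a x z k l
  identity2 k l = begin
    sgn l * sumTo l (λ j → qbin l j * pow x (l ∸ j) * A* a (k +ℕ j) z * qpow (+ (k *ℕ (l ∸ j))))
      ≈⟨ *-congˡ (sumTo-cong l λ j _ → solve 4 (λ b p f w → b :* p :* f :* w := b :* p :* w :* f) refl _ _ _ _) ⟩
    sgn l * lsum F x k l
      ≈⟨ recurrence-unique _ _ _ (lsum-recurrence F x) (rsum-recurrence G x) base l k ⟩
    sgn k * rsum G x k l
      ≈⟨ *-congˡ (sumTo-cong k λ j j≤k → trans (solve 4 (λ b p w g → b :* p :* w :* g := b :* p :* g :* w) refl _ _ _ _)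
                                               (*-congˡ (reflexive (≡.cong (pow q ∘ C2ℤ) (≡.sym (pos-∸ j≤k)))))) ⟩
    sgn k * sumTo k (λ j → qbin k j * pow x (k ∸ j) * A3 a (l +ℕ j) z x * qpow (+ C2ℤ (+ k ℤ.- + j))) ∎
    where
    base : ∀ k → sgn 0 * lsum F x k 0 ≈ sgn k * rsum G x k 0
    base k = begin
      sgn 0 * lsum F x k 0        ≈⟨ trans (*-identityˡ _) (lsum-zero F x k) ⟩
      F k                         ≈⟨ sgn-transpose k (sym (H≈sgn*F k)) ⟩
      sgn k * H k                 ≈⟨ *-congˡ (trans (rsum-⋆ G x k 0) (G-⋆-qexp k)) ⟨
      sgn k * rsum G x k 0        ∎

  F′ G′ : Seq
  F′ m = qnum (suc m) * F m
  G′ m = qnum (suc m) * G m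

  dilate-G-⋆-qexp : ∀ k → (dilate G ⋆ qexp x) (suc k) ≈ qnum (suc k) * (pow q k * H k) * ((1# - q) * x) + pow q (suc k) * H (suc k)
  dilate-G-⋆-qexp k = begin
    (dilate G ⋆ qexp x) (suc k)                            ≈⟨ ⋆-congˡ (suc k) (qexp x) (λ m _ → dilate-G m) ⟩
    ((dilate H ⋆ pow (q * - x)) ⋆ qexp x) (suc k)          ≈⟨ ⋆-assoc (suc k) (dilate H) (pow (q * - x)) (qexp x) ⟩
    (dilate H ⋆ (pow (q * - x) ⋆ qexp x)) (suc k)          ≈⟨ ⋆-degree≤1 (dilate H) (pow (q * - x) ⋆ qexp x) (pow-neg-q-⋆-qexp-vanish x) k ⟩
    qbin (suc k) k * dilate H k * (pow (q * - x) ⋆ qexp x) 1 + qbin (suc k) (suc k) * dilate H (suc k) * (pow (q * - x) ⋆ qexp x) 0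
      ≈⟨ +-cong (*-cong (*-congʳ (qbin-suc-diag k)) (pow-neg-q-⋆-qexp-one x))
                (*-cong (*-congʳ (qbin-diag (suc k))) (pow-⋆-qexp-zero (q * - x) x)) ⟩
    qnum (suc k) * dilate H k * ((1# - q) * x) + 1# * dilate H (suc k) * 1#
      ≈⟨ +-congˡ (trans (*-identityʳ _) (*-identityˡ _)) ⟩
    qnum (suc k) * (pow q k * H k) * ((1# - q) * x) + pow q (suc k) * H (suc k) ∎
    where
    dilate-G : ∀ m → dilate G m ≈ (dilate H ⋆ pow (q * - x)) m
    dilate-G m = begin
      pow q m * G m                        ≈⟨ *-congˡ (G-⋆ m) ⟩
      pow q m * (H ⋆ pow (- x)) m          ≈⟨ dilate-⋆ m H (pow (- x)) ⟩
      (dilate H ⋆ dilate (pow (- x))) m    ≈⟨ ⋆-congʳ m (dilate H) (λ i _ → dilate-pow (- x) i) ⟩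
      (dilate H ⋆ pow (q * - x)) m         ∎

  1-q*G′-⋆-qexp : ∀ k → (1# - q) * (G′ ⋆ qexp x) (suc k) ≈
                  (1# - pow q (suc (suc k))) * H (suc k) - (1# - pow q (suc k)) * (q * x * pow q k) * H k
  1-q*G′-⋆-qexp k = begin
    (1# - q) * (G′ ⋆ qexp x) (suc k)                          ≈⟨ ⋆-*ˡ (suc k) (1# - q) G′ (qexp x) ⟨
    ((λ m → (1# - q) * G′ m) ⋆ qexp x) (suc k)
      ≈⟨ ⋆-congˡ (suc k) (qexp x) (λ m _ → trans ([1-q]*[n]u≈[1-qⁿ]u (suc m) (G m))
           (solve 3 (λ q p g → (con (+ 1) :- q :* p) :* g := g :+ :- (q :* (p :* g))) refl q (pow q m) (G m))) ⟩
    ((λ m → G m + - (q * dilate G m)) ⋆ qexp x) (suc k)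
      ≈⟨ trans (⋆-distribʳ-+ (suc k) G _ (qexp x)) (+-congˡ (trans (⋆-negˡ (suc k) _ (qexp x)) (-‿cong (⋆-*ˡ (suc k) q (dilate G) (qexp x))))) ⟩
    (G ⋆ qexp x) (suc k) - q * (dilate G ⋆ qexp x) (suc k)    ≈⟨ +-cong (G-⋆-qexp (suc k)) (-‿cong (*-congˡ (dilate-G-⋆-qexp k))) ⟩
    H (suc k) - q * (qnum (suc k) * (pow q k * H k) * ((1# - q) * x) + pow q (suc k) * H (suc k))
      ≈⟨ solve 6 (λ q n p h h₁ x → h₁ :- q :* (n :* (p :* h) :* ((con (+ 1) :- q) :* x) :+ q :* p :* h₁)
                                 := (con (+ 1) :- q :* (q :* p)) :* h₁ :- (con (+ 1) :- q) :* (n :* (q :* x :* p :* h)))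
                 refl q (qnum (suc k)) (pow q k) (H k) (H (suc k)) x ⟩
    (1# - pow q (suc (suc k))) * H (suc k) - (1# - q) * (qnum (suc k) * (q * x * pow q k * H k))
      ≈⟨ +-congˡ (-‿cong (trans ([1-q]*[n]u≈[1-qⁿ]u (suc k) _) (sym (*-assoc _ _ _)))) ⟩
    (1# - pow q (suc (suc k))) * H (suc k) - (1# - pow q (suc k)) * (q * x * pow q k) * H k ∎

  -- Multiplying by 1 - q turns the factors [m+1] of F′ and G′ into 1 - q^(m+1).
  identity3-base : ∀ k → sgn 1 * lsum F′ (q * x) k 1 ≈ - (sgn (suc k) * rsum G′ x (suc k) 0)
  identity3-base k = 1-q-cancelˡ (trans lsum-side (sym rsum-side))
    where
    t = q * x * pow q k
    Q₁ = pow q (suc k)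
    Q₂ = pow q (suc (suc k))
    M = - ((1# - Q₁) * t * F k + (1# - Q₂) * F (suc k))

    lsum-side : (1# - q) * (sgn 1 * lsum F′ (q * x) k 1) ≈ M
    lsum-side = begin
      (1# - q) * (sgn 1 * lsum F′ (q * x) k 1)              ≈⟨ *-congˡ (*-cong (*-identityʳ _) (lsum-one F′ (q * x) k)) ⟩
      (1# - q) * (- 1# * (t * F′ k + F′ (suc k)))
        ≈⟨ solve 4 (λ u t f g → u :* (:- con (+ 1) :* (t :* f :+ g)) := :- (t :* (u :* f) :+ u :* g)) refl (1# - q) t (F′ k) (F′ (suc k)) ⟩
      - (t * ((1# - q) * F′ k) + (1# - q) * F′ (suc k))
        ≈⟨ -‿cong (+-cong (*-congˡ ([1-q]*[n]u≈[1-qⁿ]u (suc k) (F k))) ([1-q]*[n]u≈[1-qⁿ]u (suc (suc k)) (F (suc k)))) ⟩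
      - (t * ((1# - Q₁) * F k) + (1# - Q₂) * F (suc k))
        ≈⟨ -‿cong (+-congʳ (trans (x∙yz≈y∙xz t (1# - Q₁) (F k)) (sym (*-assoc _ _ _)))) ⟩
      M                                                     ∎

    rsum-side : (1# - q) * - (sgn (suc k) * rsum G′ x (suc k) 0) ≈ M
    rsum-side = begin
      (1# - q) * - (sgn (suc k) * rsum G′ x (suc k) 0)      ≈⟨ *-congˡ (-‿cong (*-cong (sgn-suc k) (rsum-⋆ G′ x (suc k) 0))) ⟩
      (1# - q) * - (- sgn k * (G′ ⋆ qexp x) (suc k))
        ≈⟨ solve 3 (λ u s t → u :* :- (:- s :* t) := s :* (u :* t)) refl (1# - q) (sgn k) _ ⟩
      sgn k * ((1# - q) * (G′ ⋆ qexp x) (suc k))            ≈⟨ *-congˡ (1-q*G′-⋆-qexp k) ⟩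
      sgn k * ((1# - Q₂) * H (suc k) - (1# - Q₁) * t * H k)
        ≈⟨ *-congˡ (+-cong (*-congˡ (trans (H≈sgn*F (suc k)) (*-congʳ (sgn-suc k)))) (-‿cong (*-congˡ (H≈sgn*F k)))) ⟩
      sgn k * ((1# - Q₂) * (- sgn k * F (suc k)) - (1# - Q₁) * t * (sgn k * F k))
        ≈⟨ solve 6 (λ s t Q₁ Q₂ f f₁ → s :* ((con (+ 1) :- Q₂) :* (:- s :* f₁) :- (con (+ 1) :- Q₁) :* t :* (s :* f))
                                     := (s :* s) :* :- ((con (+ 1) :- Q₁) :* t :* f :+ (con (+ 1) :- Q₂) :* f₁))
                   refl (sgn k) t Q₁ Q₂ (F k) (F (suc k)) ⟩
      sgn k * sgn k * M                                     ≈⟨ trans (*-congʳ (sgn-sq k)) (*-identityˡ M) ⟩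
      M                                                     ∎

  identity3-core : ∀ l k → sgn (suc l) * lsum F′ (q * x) k (suc l) ≈ - (sgn (suc k) * rsum G′ x (suc k) l)
  identity3-core = recurrence-unique (λ k → q * x * pow q k) _ _ (λ k l → lsum-recurrence F′ (q * x) k (suc l))
    (recurrence-neg _ _ (recurrence-cong _ (λ k → trans (x∙yz≈y∙xz x q (pow q k)) (sym (*-assoc _ _ _)))
                                             (λ k l → rsum-recurrence G′ x (suc k) l)))
    identity3-base

  identity3 : ∀ k l → Identity3 a x z k l
  identity3 k l = pow-q-cancelˡ k (begin
    pow q k * (sgn (suc l) * sumTo (suc l) tL)          ≈⟨ trans (*-signed-sumTo _ _ (suc l) tL) (*-congˡ (sumTo-cong (suc l) termL)) ⟩
    sgn (suc l) * lsum F′ (q * x) k (suc l)             ≈⟨ identity3-core l k ⟩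
    - (sgn (suc k) * rsum G′ x (suc k) l)               ≈⟨ -‿cong (*-congʳ (sgn-suc k)) ⟩
    - (- sgn k * rsum G′ x (suc k) l)                   ≈⟨ solve 2 (λ s t → :- (:- s :* t) := s :* t) refl (sgn k) _ ⟩
    sgn k * rsum G′ x (suc k) l                         ≈⟨ trans (*-signed-sumTo _ _ (suc k) tR) (*-congˡ (sumTo-cong (suc k) termR)) ⟨
    pow q k * (sgn k * sumTo (suc k) tR)                ∎)
    where
    eL eR : ℕ → ℤ
    eL j = + (suc k) ℤ.* (+ l ℤ.- + j) ℤ.+ + 1
    eR j = + C2ℤ (+ k ℤ.- + j) ℤ.- + j
    tL tR : ℕ → Carrier
    tL j = qbin (suc l) j * pow x (suc l ∸ j) * qnum (k +ℕ j +ℕ 1) * A* a (k +ℕ j) z * qpow (eL j)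
    tR j = qbin (suc k) j * pow x (suc k ∸ j) * qnum (l +ℕ j +ℕ 1) * A3 a (l +ℕ j) z x * qpow (eR j)

    termL : ∀ j → j ℕ.≤ suc l → pow q k * tL j ≈ qbin (suc l) j * pow (q * x) (suc l ∸ j) * pow q (k *ℕ (suc l ∸ j)) * F′ (k +ℕ j)
    termL j j≤1+l = begin
      pow q k * tL j
        ≈⟨ solve 6 (λ p b w n f e → p :* (b :* w :* n :* f :* e) := b :* w :* (n :* f) :* (p :* e)) refl _ _ _ _ _ _ ⟩
      qbin (suc l) j * pow x m * (qnum (k +ℕ j +ℕ 1) * F (k +ℕ j)) * (pow q k * qpow (eL j))
        ≈⟨ *-cong (*-congˡ (*-congʳ (reflexive (≡.cong qnum (ℕP.+-comm (k +ℕ j) 1)))))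
                  (qpow-shift (eL j) k _ ([1+k][l-j]+1+k≡[1+k][1+l∸j] k l j j≤1+l)) ⟩
      qbin (suc l) j * pow x m * F′ (k +ℕ j) * pow q (m +ℕ k *ℕ m)  ≈⟨ *-congˡ (pow-+ q m (k *ℕ m)) ⟩
      qbin (suc l) j * pow x m * F′ (k +ℕ j) * (pow q m * pow q (k *ℕ m))
        ≈⟨ solve 5 (λ b w f u v → b :* w :* f :* (u :* v) := b :* (u :* w) :* v :* f) refl _ _ _ _ _ ⟩
      qbin (suc l) j * (pow q m * pow x m) * pow q (k *ℕ m) * F′ (k +ℕ j) ≈⟨ *-congʳ (*-congʳ (*-congˡ (pow-distrib-* q x m))) ⟨
      qbin (suc l) j * pow (q * x) m * pow q (k *ℕ m) * F′ (k +ℕ j) ∎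
      where m = suc l ∸ j

    termR : ∀ j → j ℕ.≤ suc k → pow q k * tR j ≈ qbin (suc k) j * pow x (suc k ∸ j) * pow q (C2 (suc k ∸ j)) * G′ (l +ℕ j)
    termR j j≤1+k = begin
      pow q k * tR j
        ≈⟨ solve 6 (λ p b w n g e → p :* (b :* w :* n :* g :* e) := b :* w :* (p :* e) :* (n :* g)) refl _ _ _ _ _ _ ⟩
      qbin (suc k) j * pow x (suc k ∸ j) * (pow q k * qpow (eR j)) * (qnum (l +ℕ j +ℕ 1) * G (l +ℕ j))
        ≈⟨ *-cong (*-congˡ (qpow-shift (eR j) k _ (C2[k-j]-j+k≡C2[1+k∸j] k j j≤1+k)))
                  (*-congʳ (reflexive (≡.cong qnum (ℕP.+-comm (l +ℕ j) 1)))) ⟩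
      qbin (suc k) j * pow x (suc k ∸ j) * pow q (C2 (suc k ∸ j)) * G′ (l +ℕ j) ∎

  G-zero : G 0 ≈ a 0
  G-zero = begin
    G 0                                         ≈⟨ trans (Agen-⋆ 0 P) (⋆-zero α P) ⟩
    α 0 * P 0
      ≈⟨ *-congˡ (trans (⋆-zero (pow 1#) (pow (- z) ⋆ pow (- x))) (*-congˡ (⋆-zero (pow (- z)) (pow (- x))))) ⟩
    1# * a 0 * 1# * (1# * (1# * 1#))
      ≈⟨ solve 1 (λ a → con (+ 1) :* a :* con (+ 1) :* (con (+ 1) :* (con (+ 1) :* con (+ 1))) := a) refl (a 0) ⟩
    a 0                                         ∎
    where P = pow3 1# (- z) (- x)

  F″ G″ : Seq
  F″ m = F (suc m) * qnum⁻¹ (suc m)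
  G″ m = G (suc m) * qnum⁻¹ (suc m)

  lhs₁ : ℕ → ℕ → Carrier
  lhs₁ k l = sgn l * lsum F″ x k l + sgn k * rsum G″ x k l

  closedForm : ℕ → ℕ → Carrier
  closedForm k l = pow q (k *ℕ l +ℕ C2 (suc k)) * (a 0 * pow (- x) (suc (k +ℕ l)) * β k l)

  closedForm-recurrence : Recurrence (λ k → x * pow q k) closedForm
  closedForm-recurrence k l = begin
    closedForm k (suc l)
      ≡⟨ ≡.cong₂ (λ e n → pow q e * (a 0 * pow (- x) (suc n) * β k (suc l))) (k[1+l]+c≡kl+c+k k l (C2 (suc k))) (ℕP.+-suc k l) ⟩
    pow q (e +ℕ k) * (a 0 * X₂ * β k (suc l))                 ≈⟨ *-cong (pow-+ q e k) (*-congˡ (β-recurrence k l)) ⟩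
    P * Pk * (a 0 * (- x * X₁) * (β k l - Pl * β (suc k) l))
      ≈⟨ solve 8 (λ P Pk Pl a₀ x X₁ b₀ b₁ → P :* Pk :* (a₀ :* (:- x :* X₁) :* (b₀ :- Pl :* b₁))
                 := :- (P :* Pk :* Pl :* (a₀ :* (:- x :* X₁) :* b₁)) :- x :* Pk :* (P :* (a₀ :* X₁ :* b₀)))
                 refl P Pk Pl (a 0) x X₁ (β k l) (β (suc k) l) ⟩
    - (P * Pk * Pl * (a 0 * X₂ * β (suc k) l)) - x * Pk * closedForm k l
      ≈⟨ +-congʳ (-‿cong (*-congʳ (trans (*-congʳ (sym (pow-+ q e k))) (sym (pow-+ q (e +ℕ k) (suc l)))))) ⟩
    - (pow q ((e +ℕ k) +ℕ suc l) * (a 0 * X₂ * β (suc k) l)) - x * Pk * closedForm k l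
      ≡⟨ ≡.cong (λ e′ → - (pow q e′ * (a 0 * X₂ * β (suc k) l)) - x * Pk * closedForm k l) ([1+k]l+C2[2+k]≡kl+C2[1+k]+k+[1+l] k l) ⟨
    - closedForm (suc k) l - x * pow q k * closedForm k l     ∎
    where
    e = k *ℕ l +ℕ C2 (suc k)
    P = pow q e
    Pk = pow q k
    Pl = pow q (suc l)
    X₁ = pow (- x) (suc (k +ℕ l))
    X₂ = pow (- x) (suc (suc (k +ℕ l)))

  closedForm-zero : ∀ k → qnum (suc k) * closedForm k 0 ≈ a 0 * pow (- x) (suc k) * pow q (C2 (suc k))
  closedForm-zero k = begin
    qnum (suc k) * closedForm k 0
      ≡⟨ ≡.cong₂ (λ e n → qnum (suc k) * (pow q (e +ℕ C2 (suc k)) * (a 0 * pow (- x) (suc n) * (qnum⁻¹ (suc n) * qbin⁻¹ n k))))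
                 (ℕP.*-zeroʳ k) (ℕP.+-identityʳ k) ⟩
    qnum (suc k) * (pow q (C2 (suc k)) * (a 0 * pow (- x) (suc k) * (qnum⁻¹ (suc k) * qbin⁻¹ k k)))
      ≈⟨ solve 6 (λ n p a X n⁻¹ b⁻¹ → n :* (p :* (a :* X :* (n⁻¹ :* b⁻¹))) := n :* n⁻¹ :* (a :* X :* p :* b⁻¹)) refl _ _ _ _ _ _ ⟩
    qnum (suc k) * qnum⁻¹ (suc k) * (a 0 * pow (- x) (suc k) * pow q (C2 (suc k)) * qbin⁻¹ k k)
      ≈⟨ *-cong (qnum-inverse k) (*-congˡ qbin⁻¹-diag) ⟩
    1# * (a 0 * pow (- x) (suc k) * pow q (C2 (suc k)) * 1#)  ≈⟨ trans (*-identityˡ _) (*-identityʳ _) ⟩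
    a 0 * pow (- x) (suc k) * pow q (C2 (suc k))              ∎
    where
    qbin⁻¹-diag : qbin⁻¹ k k ≈ 1#
    qbin⁻¹-diag = trans (sym (*-identityˡ _)) (trans (*-congʳ (sym (qbin-diag k))) (qbin-inverse k k ℕP.≤-refl))

  lhs₁-zero : ∀ k → qnum (suc k) * lhs₁ k 0 ≈ a 0 * pow (- x) (suc k) * pow q (C2 (suc k))
  lhs₁-zero k = begin
    qnum (suc k) * lhs₁ k 0
      ≈⟨ *-congˡ (+-cong (trans (*-identityˡ _) (lsum-zero F″ x k)) (*-congˡ (rsum-⋆ G″ x k 0))) ⟩
    qnum (suc k) * (F″ k + s * (G″ ⋆ qexp x) k)
      ≈⟨ solve 4 (λ n f s c → n :* (f :+ s :* c) := n :* f :+ s :* (n :* c)) refl (qnum (suc k)) (F″ k) s _ ⟩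
    qnum (suc k) * F″ k + s * (qnum (suc k) * (G″ ⋆ qexp x) k)
      ≈⟨ +-cong (trans (x∙yz≈y∙xz _ _ _) (trans (*-congˡ (qnum-inverse k)) (*-identityʳ _))) (*-congˡ (qnum-⋆-antiderivative k G (qexp x))) ⟩
    F (suc k) + s * ((G ⋆ qexp x) (suc k) - G 0 * qexp x (suc k))
      ≈⟨ +-congˡ (*-congˡ (+-cong (trans (G-⋆-qexp (suc k)) (trans (H≈sgn*F (suc k)) (*-congʳ (sgn-suc k)))) (-‿cong (*-congʳ G-zero)))) ⟩
    F (suc k) + s * (- s * F (suc k) - a 0 * (pow x (suc k) * pow q (C2 (suc k))))
      ≈⟨ solve 5 (λ f s a w p → f :+ s :* (:- s :* f :- a :* (w :* p)) := f :* (con (+ 1) :- s :* s) :+ a :* (:- s :* w) :* p)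
                 refl (F (suc k)) s (a 0) (pow x (suc k)) (pow q (C2 (suc k))) ⟩
    F (suc k) * (1# - s * s) + a 0 * (- s * pow x (suc k)) * pow q (C2 (suc k))
      ≈⟨ +-cong (trans (*-congˡ (trans (+-congˡ (-‿cong (sgn-sq k))) (-‿inverseʳ 1#))) (zeroʳ _))
                (*-congʳ (*-congˡ (sym (trans (pow-neg x (suc k)) (*-congʳ (sgn-suc k)))))) ⟩
    0# + a 0 * pow (- x) (suc k) * pow q (C2 (suc k))  ≈⟨ +-identityˡ _ ⟩
    a 0 * pow (- x) (suc k) * pow q (C2 (suc k))       ∎
    where s = sgn k

  lhs₁≈closedForm : ∀ l k → lhs₁ k l ≈ closedForm k l
  lhs₁≈closedForm = recurrence-unique _ lhs₁ closedForm
    (recurrence-+ _ _ _ (lsum-recurrence F″ x) (rsum-recurrence G″ x)) closedForm-recurrence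
    (λ k → qnum-cancelˡ k (trans (lhs₁-zero k) (sym (closedForm-zero k))))

  identity1 : ∀ k l → Identity1 a x z k l
  identity1 k l = pow-q-cancelˡ e (begin
    pow q e * (sgn l * sumTo l tA + sgn k * sumTo k tB)
      ≈⟨ trans (distribˡ _ _ _) (+-cong (*-signed-sumTo _ _ l tA) (*-signed-sumTo _ _ k tB)) ⟩
    sgn l * sumTo l (λ j → pow q e * tA j) + sgn k * sumTo k (λ j → pow q e * tB j)
      ≈⟨ +-cong (*-congˡ (sumTo-cong l termA)) (*-congˡ (sumTo-cong k termB)) ⟩
    lhs₁ k l
      ≈⟨ lhs₁≈closedForm l k ⟩
    closedForm k l
      ≡⟨ ≡.cong (λ n → pow q e * (a 0 * pow (- x) n * (qnum⁻¹ n * qbin⁻¹ (k +ℕ l) k))) (ℕP.+-comm 1 (k +ℕ l)) ⟩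
    pow q e * (a 0 * pow (- x) (k +ℕ l +ℕ 1) * (qnum⁻¹ (k +ℕ l +ℕ 1) * qbin⁻¹ (k +ℕ l) k)) ∎)
    where
    e = k *ℕ l +ℕ C2 (suc k)
    eA eB : ℕ → ℤ
    eA j = ℤ.- (+ (k *ℕ j +ℕ C2 (suc k)))
    eB j = + C2 (suc j) ℤ.- + (k *ℕ (l +ℕ j +ℕ 1))
    tA tB : ℕ → Carrier
    tA j = qbin l j * pow x (l ∸ j) * A* a (k +ℕ j +ℕ 1) z * qnum⁻¹ (k +ℕ j +ℕ 1) * qpow (eA j)
    tB j = qbin k j * pow x (k ∸ j) * A3 a (l +ℕ j +ℕ 1) z x * qnum⁻¹ (l +ℕ j +ℕ 1) * qpow (eB j)

    reorder : ∀ p b w f i u → p * (b * w * f * i * u) ≈ b * w * (p * u) * (f * i)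
    reorder = solve 6 (λ p b w f i u → p :* (b :* w :* f :* i :* u) := b :* w :* (p :* u) :* (f :* i)) refl

    termA : ∀ j → j ℕ.≤ l → pow q e * tA j ≈ qbin l j * pow x (l ∸ j) * pow q (k *ℕ (l ∸ j)) * F″ (k +ℕ j)
    termA j j≤l = trans (reorder _ _ _ _ _ _)
      (*-cong (*-congˡ (qpow-shift (eA j) e _ (-[kj+c]+[kl+c]≡k[l∸j] k l j (C2 (suc k)) j≤l)))
              (reflexive (≡.cong (λ n → A* a n z * qnum⁻¹ n) (ℕP.+-comm (k +ℕ j) 1))))

    termB : ∀ j → j ℕ.≤ k → pow q e * tB j ≈ qbin k j * pow x (k ∸ j) * pow q (C2 (k ∸ j)) * G″ (l +ℕ j)
    termB j j≤k = trans (reorder _ _ _ _ _ _)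
      (*-cong (*-congˡ (qpow-shift (eB j) e _ (C2[1+j]-k[l+j+1]+[kl+C2[1+k]]≡C2[k∸j] k l j j≤k)))
              (reflexive (≡.cong (λ n → A3 a n z x * qnum⁻¹ n) (ℕP.+-comm (l +ℕ j) 1))))

theorem2 : ∀ {c ℓ} (R : CommutativeRing c ℓ) (Q : QqAlgebra R)
             (a : ℕ → CommutativeRing.Carrier R)
             (x z : CommutativeRing.Carrier R) (k l : ℕ) →
             QDefs.Identity1 R Q a x z k l
             × QDefs.Identity2 R Q a x z k l
             × QDefs.Identity3 R Q a x z k l
theorem2 R Q a x z k l = identity1 k l , identity2 k l , identity3 k l
  where open Identities R Q a x z
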